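{- For all integers $n\ge 1$ and $k$, $$\frac{1}{(2n)!}\sum_{m=0}^n\left[ {n \atop m} \right]_2\mathfrak B_{2m}^{(k)}=\frac{1}{(2n+1)^k}\qquad\text{and}\qquad\sum_{m=0}^n\left\{ {n \atop m} \right\}_2 4^{n-m}\mathfrak C_{2m}^{(k)}=\frac{1}{(2n+1)^k}.$$
   Context: The Stirling numbers of the first kind with level $2$ are defined by $\left[ {n \atop k} \right]_2=\left[ {n-1 \atop k-1} \right]_2+(n-1)^2\left[ {n-1 \atop k} \right]_2$, and those of the second kind with level $2$ by $\left\{ {n \atop k} \right\}_2=\left\{ {n-1 \atop k-1} \right\}_2+k^2\left\{ {n-1 \atop k} \right\}_2$, both with initial values $1$ at $(0,0)$ and $0$ at $(n,0)$ and $(0,n)$ for $n\ge1$. For an integer $k$, the poly-Bernoulli numbers with level $2$ are defined by $\sum_{n\ge0}\mathfrak B_n^{(k)}\frac{x^n}{n!}=\frac{{\rm Li}_{2,k}(2\sin(x/2))}{2\sin(x/2)}$ with ${\rm Li}_{2,k}(z)=\sum_{n\ge0}\frac{z^{2n+1}}{(2n+1)^k}$, and the poly-Cauchy numbers with level $2$ by $\sum_{n\ge0}\mathfrak C_n^{(k)}\frac{x^n}{n!}={\rm Lif}_{2,k}({\rm arcsinh}\,x)$ with ${\rm Lif}_{2,k}(z)=\sum_{m\ge0}\frac{z^{2m}}{(2m)!(2m+1)^k}$ (as power series). -}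

module Defs where

open import Data.Nat as ℕ using (ℕ; zero; suc; _∸_; _!; _^_)
open import Data.Nat.Properties using (m^n≢0; _!≢0)
open import Data.Integer as ℤ using (ℤ; +_; -[1+_])
open import Data.Rational using (ℚ; 0ℚ; 1ℚ; _+_; _*_; -_; _/_)

stirling1₂ : ℕ → ℕ → ℕ
stirling1₂ zero    zero    = 1
stirling1₂ zero    (suc k) = 0
stirling1₂ (suc n) zero    = 0
stirling1₂ (suc n) (suc k) = stirling1₂ n k ℕ.+ (n ℕ.* n) ℕ.* stirling1₂ n (suc k)

stirling2₂ : ℕ → ℕ → ℕ
stirling2₂ zero    zero    = 1
stirling2₂ zero    (suc k) = 0
stirling2₂ (suc n) zero    = 0
stirling2₂ (suc n) (suc k) = stirling2₂ n k ℕ.+ (suc k ℕ.* suc k) ℕ.* stirling2₂ n (suc k)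

ℕ→ℚ : ℕ → ℚ
ℕ→ℚ n = + n / 1

inv! : ℕ → ℚ
inv! n = _/_ (+ 1) (n !) {{n !≢0}}

sign : ℕ → ℚ
sign zero    = 1ℚ
sign (suc j) = - sign j

invPowℤ : ℕ → ℤ → ℚ
invPowℤ m (+ j)     = _/_ (+ 1) (suc m ^ j) {{m^n≢0 (suc m) j}}
invPowℤ m -[1+ j ]  = ℕ→ℚ (suc m ^ suc j)

sumTo : ℕ → (ℕ → ℚ) → ℚ
sumTo zero    f = f 0
sumTo (suc N) f = sumTo N f + f (suc N)

-- Formal power series over ℚ, represented by coefficient functions ℕ → ℚ

Series : Set
Series = ℕ → ℚ

-- the odd series Σ_j c j x^(2j+1)
oddSeries : (ℕ → ℚ) → Series
oddSeries c zero          = 0ℚ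
oddSeries c (suc zero)    = c 0
oddSeries c (suc (suc i)) = oddSeries (λ j → c (suc j)) i

-- coefficient of x^N in a^j (Cauchy-product powers)
powCoeff : Series → ℕ → ℕ → ℚ
powCoeff a zero    zero    = 1ℚ
powCoeff a zero    (suc N) = 0ℚ
powCoeff a (suc j) N       = sumTo N (λ i → a i * powCoeff a j (N ∸ i))

-- 2 sin(x/2) = Σ_j (-1)^j x^(2j+1) / (4^j (2j+1)!)
twoSinHalf : Series
twoSinHalf = oddSeries (λ j → sign j * (_/_ (+ 1) (4 ^ j) {{m^n≢0 4 j}} * inv! (suc (2 ℕ.* j))))

-- arcsinh x = Σ_j (-1)^j (2j)! / (4^j (j!)^2 (2j+1)) x^(2j+1)
arcsinhS : Series
arcsinhS = oddSeries (λ j → sign j * (ℕ→ℚ ((2 ℕ.* j) !)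
             * (_/_ (+ 1) (4 ^ j) {{m^n≢0 4 j}} * (inv! j * (inv! j * invPowℤ (2 ℕ.* j) (+ 1))))))

-- Poly-Bernoulli numbers with level 2:
--   Σ 𝔅_N^(k) x^N/N! = Li_{2,k}(2 sin(x/2)) / (2 sin(x/2))
--                    = Σ_{j≥0} (2 sin(x/2))^(2j) / (2j+1)^k .
-- Since (2 sin(x/2))^(2j) has order 2j, only j ≤ N contribute to x^N.
polyBernoulli₂ : ℕ → ℤ → ℚ
polyBernoulli₂ N k =
  ℕ→ℚ (N !) * sumTo N (λ j → powCoeff twoSinHalf (2 ℕ.* j) N * invPowℤ (2 ℕ.* j) k)

-- Poly-Cauchy numbers with level 2:
--   Σ ℭ_N^(k) x^N/N! = Lif_{2,k}(arcsinh x)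
--                    = Σ_{m≥0} (arcsinh x)^(2m) / ((2m)! (2m+1)^k) .
-- Only m ≤ N contribute to x^N.
polyCauchy₂ : ℕ → ℤ → ℚ
polyCauchy₂ N k =
  ℕ→ℚ (N !) * sumTo N (λ m → powCoeff arcsinhS (2 ℕ.* m) N * (inv! (2 ℕ.* m) * invPowℤ (2 ℕ.* m) k))

{-# OPTIONS --safe #-}
-- With s = 2 sin(x/2) and z = arcsinh x, let t(m,j) and u(m,j) be (2m)!/(2j)! times the coefficient of
-- x^(2m) in s^(2j) and in z^(2j). Unfolding the generating functions, 𝔅_2m = Σ_j t(m,j) (2j)! / (2j+1)^k
-- and ℭ_2m = Σ_j u(m,j) / (2j+1)^k, so the two identities say that [n,m]₂ is inverse to t and
-- 4^(n-m) {n,m}₂ is inverse to u. From s″ = -¼ s, s′² + ¼ s² = 1, (1+x²) z″ = -x z′ and (1+x²) z′² = 1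
-- one gets t(m+1,j+1) = t(m,j) - (j+1)² t(m,j+1) and u(m+1,j+1) = u(m,j) - (2m)² u(m,j+1): the signed
-- Stirling recurrences dual to those of [n,m]₂ (weight n²) and 4^(n-m) {n,m}₂ (weight (2m)²), and
-- triangles with dual recurrences are inverse to each other by induction on n.
module Submission where

module PolyBernoulliCauchy where

  open import Defs
  open import Data.Nat as ℕ using (ℕ; zero; suc; _∸_; _!; _^_; _≤_; _<_; z≤n; s≤s)
  import Data.Nat.Properties as ℕₚ
  open import Data.Nat.Properties using (_!≢0)
  open import Data.Integer as ℤ using (ℤ; +_)
  import Data.Integer.Properties as ℤₚ
  open import Data.Rational using (ℚ; 0ℚ; 1ℚ; _/_; _+_; _*_; -_; toℚᵘ)
  import Data.Rational.Properties as ℚₚ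
  import Data.Rational.Unnormalised as ℚᵘ
  import Data.Rational.Unnormalised.Properties as ℚᵘₚ
  open import Data.Sum using (inj₁; inj₂)
  open import Relation.Binary.PropositionalEquality using (_≡_; refl; sym; trans; cong; cong₂; module ≡-Reasoning)
  open import Relation.Nullary using (Dec; yes; no)
  open import Data.Rational.Solver using (module +-*-Solver)
  open +-*-Solver using (solve; _:+_; _:*_; :-_; _:=_; con)
  import Data.Nat.Solver as ℕ-Solver

  -- ι is an opaque copy of ℕ→ℚ, so that normalisation never unfolds the gcd computation of + n / 1.
  opaque
    ι : ℕ → ℚ
    ι = ℕ→ℚ

  opaque
    unfolding ι

    ι-def : ∀ n → ι n ≡ ℕ→ℚ n
    ι-def n = refl

    ι-0 : ι 0 ≡ 0ℚ
    ι-0 = refl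

    ι-1 : ι 1 ≡ 1ℚ
    ι-1 = refl

    private
      toℚᵘ-ι : ∀ n → toℚᵘ (ι n) ℚᵘ.≃ ℚᵘ.mkℚᵘ (+ n) 0
      toℚᵘ-ι n = ℚₚ.toℚᵘ-fromℚᵘ (ℚᵘ.mkℚᵘ (+ n) 0)

    ι-+ : ∀ a b → ι (a ℕ.+ b) ≡ ι a + ι b
    ι-+ a b = ℚₚ.toℚᵘ-injective (ℚᵘₚ.≃-trans (toℚᵘ-ι (a ℕ.+ b)) (ℚᵘₚ.≃-trans (ℚᵘ.*≡* num)
      (ℚᵘₚ.≃-sym (ℚᵘₚ.≃-trans (ℚₚ.toℚᵘ-homo-+ (ι a) (ι b)) (ℚᵘₚ.+-cong (toℚᵘ-ι a) (toℚᵘ-ι b))))))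
      where
      num : + (a ℕ.+ b) ℤ.* + 1 ≡ (+ a ℤ.* + 1 ℤ.+ + b ℤ.* + 1) ℤ.* + 1
      num = cong (ℤ._* + 1) (trans (ℤₚ.pos-+ a b)
              (cong₂ ℤ._+_ (sym (ℤₚ.*-identityʳ (+ a))) (sym (ℤₚ.*-identityʳ (+ b)))))

    ι-* : ∀ a b → ι (a ℕ.* b) ≡ ι a * ι b
    ι-* a b = ℚₚ.toℚᵘ-injective (ℚᵘₚ.≃-trans (toℚᵘ-ι (a ℕ.* b)) (ℚᵘₚ.≃-trans
      (ℚᵘ.*≡* (cong (ℤ._* + 1) (ℤₚ.pos-* a b)))
      (ℚᵘₚ.≃-sym (ℚᵘₚ.≃-trans (ℚₚ.toℚᵘ-homo-* (ι a) (ι b)) (ℚᵘₚ.*-cong (toℚᵘ-ι a) (toℚᵘ-ι b))))))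

    recip-*-ι : ∀ d .{{_ : ℕ.NonZero d}} → (+ 1 / d) * ι d ≡ 1ℚ
    recip-*-ι (suc d) = ℚₚ.toℚᵘ-injective (ℚᵘₚ.≃-trans (ℚₚ.toℚᵘ-homo-* (+ 1 / suc d) (ι (suc d)))
      (ℚᵘₚ.≃-trans (ℚᵘₚ.*-cong (ℚₚ.toℚᵘ-fromℚᵘ (ℚᵘ.mkℚᵘ (+ 1) d)) (toℚᵘ-ι (suc d)))
                   (ℚᵘ.*≡* num)))
      where
      num : (+ 1 ℤ.* + suc d) ℤ.* + 1 ≡ + 1 ℤ.* + (suc d ℕ.* 1)
      num = trans (ℤₚ.*-identityʳ _) (trans (ℤₚ.*-identityˡ _)
              (sym (trans (ℤₚ.*-identityˡ _) (cong +_ (ℕₚ.*-identityʳ (suc d))))))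

  ι-suc : ∀ n → ι (suc n) ≡ 1ℚ + ι n
  ι-suc n = trans (ι-+ 1 n) (cong (_+ ι n) ι-1)

  recip-unique : ∀ d .{{_ : ℕ.NonZero d}} x → x * ι d ≡ 1ℚ → x ≡ + 1 / d
  recip-unique d x x*d≡1 = begin
    x                     ≡⟨ sym (ℚₚ.*-identityʳ x) ⟩
    x * 1ℚ                ≡⟨ cong (x *_) (sym (trans (ℚₚ.*-comm (ι d) _) (recip-*-ι d))) ⟩
    x * (ι d * (+ 1 / d)) ≡⟨ sym (ℚₚ.*-assoc x _ _) ⟩
    (x * ι d) * (+ 1 / d) ≡⟨ cong (_* (+ 1 / d)) x*d≡1 ⟩
    1ℚ * (+ 1 / d)        ≡⟨ ℚₚ.*-identityˡ _ ⟩
    + 1 / d               ∎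
    where open ≡-Reasoning

  -1*x≡-x : ∀ x → - 1ℚ * x ≡ - x
  -1*x≡-x x = trans (sym (ℚₚ.neg-distribˡ-* 1ℚ x)) (cong -_ (ℚₚ.*-identityˡ x))

  ι-suc-cancelˡ : ∀ n {x y} → ι (suc n) * x ≡ ι (suc n) * y → x ≡ y
  ι-suc-cancelˡ n {x} {y} eq = begin
    x                   ≡⟨ sym (ℚₚ.*-identityˡ x) ⟩
    1ℚ * x              ≡⟨ cong (_* x) (sym (recip-*-ι (suc n))) ⟩
    (r * ι (suc n)) * x ≡⟨ ℚₚ.*-assoc r _ x ⟩
    r * (ι (suc n) * x) ≡⟨ cong (r *_) eq ⟩
    r * (ι (suc n) * y) ≡⟨ sym (ℚₚ.*-assoc r _ y) ⟩
    (r * ι (suc n)) * y ≡⟨ cong (_* y) (recip-*-ι (suc n)) ⟩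
    1ℚ * y              ≡⟨ ℚₚ.*-identityˡ y ⟩
    y                   ∎
    where
    open ≡-Reasoning
    r = + 1 / suc n

  ι-! : ∀ n → ι (suc n !) ≡ ι (suc n) * ι (n !)
  ι-! n = ι-* (suc n) (n !)

  inv!-suc : ∀ n → inv! (suc n) * ι (suc n) ≡ inv! n
  inv!-suc n = recip-unique (n !) {{n !≢0}} _ (begin
    (inv! (suc n) * ι (suc n)) * ι (n !) ≡⟨ ℚₚ.*-assoc (inv! (suc n)) _ _ ⟩
    inv! (suc n) * (ι (suc n) * ι (n !)) ≡⟨ cong (inv! (suc n) *_) (sym (ι-! n)) ⟩
    inv! (suc n) * ι (suc n !)           ≡⟨ recip-*-ι (suc n !) {{suc n !≢0}} ⟩
    1ℚ                                   ∎)
    where open ≡-Reasoning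

  inv!-suc-suc : ∀ n → inv! (suc (suc n)) * (ι (suc (suc n)) * ι (suc n)) ≡ inv! n
  inv!-suc-suc n = begin
    inv! (suc (suc n)) * (ι (suc (suc n)) * ι (suc n)) ≡⟨ sym (ℚₚ.*-assoc (inv! (suc (suc n))) _ _) ⟩
    (inv! (suc (suc n)) * ι (suc (suc n))) * ι (suc n) ≡⟨ cong (_* ι (suc n)) (inv!-suc (suc n)) ⟩
    inv! (suc n) * ι (suc n)                           ≡⟨ inv!-suc n ⟩
    inv! n                                             ∎
    where open ≡-Reasoning

  ¼ : ℚ
  ¼ = + 1 / 4

  recip4^ : ℕ → ℚ
  recip4^ j = (+ 1 / (4 ^ j)) {{ℕₚ.m^n≢0 4 j}}

  recip4^-suc : ∀ j → recip4^ (suc j) ≡ ¼ * recip4^ j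
  recip4^-suc j = sym (recip-unique (4 ^ suc j) {{ℕₚ.m^n≢0 4 (suc j)}} _ (begin
    (¼ * recip4^ j) * ι (4 ℕ.* 4 ^ j)          ≡⟨ cong ((¼ * recip4^ j) *_) (ι-* 4 (4 ^ j)) ⟩
    (¼ * recip4^ j) * (ι 4 * ι (4 ^ j))        ≡⟨ solve 4 (λ a b c d → (a :* b) :* (c :* d) := (a :* c) :* (b :* d))
                                                    refl ¼ (recip4^ j) (ι 4) (ι (4 ^ j)) ⟩
    (¼ * ι 4) * (recip4^ j * ι (4 ^ j))        ≡⟨ cong₂ _*_ (recip-*-ι 4) (recip-*-ι (4 ^ j) {{ℕₚ.m^n≢0 4 j}}) ⟩
    1ℚ                                         ∎))
    where open ≡-Reasoning

  invPowℤ-1-*-ι : ∀ m → invPowℤ m (+ 1) * ι (suc m) ≡ 1ℚ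
  invPowℤ-1-*-ι m = trans (cong (λ t → invPowℤ m (+ 1) * ι t) (sym (ℕₚ.*-identityʳ (suc m))))
    (recip-*-ι (suc m ^ 1) {{ℕₚ.m^n≢0 (suc m) 1}})

  -- Finite sums

  sumTo-cong : ∀ N {f g : ℕ → ℚ} → (∀ i → i ≤ N → f i ≡ g i) → sumTo N f ≡ sumTo N g
  sumTo-cong zero    f≗g = f≗g 0 z≤n
  sumTo-cong (suc N) f≗g =
    cong₂ _+_ (sumTo-cong N (λ i i≤N → f≗g i (ℕₚ.m≤n⇒m≤1+n i≤N))) (f≗g (suc N) ℕₚ.≤-refl)

  sumTo-zero : ∀ N {f : ℕ → ℚ} → (∀ i → i ≤ N → f i ≡ 0ℚ) → sumTo N f ≡ 0ℚ
  sumTo-zero zero    f≗0 = f≗0 0 z≤n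
  sumTo-zero (suc N) f≗0 = trans
    (cong₂ _+_ (sumTo-zero N (λ i i≤N → f≗0 i (ℕₚ.m≤n⇒m≤1+n i≤N))) (f≗0 (suc N) ℕₚ.≤-refl))
    (ℚₚ.+-identityˡ 0ℚ)

  sumTo-+ : ∀ N (f g : ℕ → ℚ) → sumTo N (λ i → f i + g i) ≡ sumTo N f + sumTo N g
  sumTo-+ zero    f g = refl
  sumTo-+ (suc N) f g = trans (cong (_+ (f (suc N) + g (suc N))) (sumTo-+ N f g))
    (solve 4 (λ a b c d → (a :+ b) :+ (c :+ d) := (a :+ c) :+ (b :+ d)) refl
      (sumTo N f) (sumTo N g) (f (suc N)) (g (suc N)))

  sumTo-*ˡ : ∀ N q (f : ℕ → ℚ) → sumTo N (λ i → q * f i) ≡ q * sumTo N f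
  sumTo-*ˡ zero    q f = refl
  sumTo-*ˡ (suc N) q f =
    trans (cong (_+ (q * f (suc N))) (sumTo-*ˡ N q f)) (sym (ℚₚ.*-distribˡ-+ q _ _))

  sumTo-suc : ∀ N (f : ℕ → ℚ) → sumTo (suc N) f ≡ f 0 + sumTo N (λ i → f (suc i))
  sumTo-suc zero    f = refl
  sumTo-suc (suc N) f = trans (cong (_+ f (suc (suc N))) (sumTo-suc N f)) (ℚₚ.+-assoc (f 0) _ _)

  sumTo-∘suc : ∀ N (f : ℕ → ℚ) → sumTo N (λ i → f (suc i)) ≡ sumTo (suc N) f + - f 0
  sumTo-∘suc N f = trans
    (solve 2 (λ x y → x := (y :+ x) :+ (:- y)) refl (sumTo N (λ i → f (suc i))) (f 0))
    (cong (_+ - f 0) (sym (sumTo-suc N f)))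

  sumTo-comm : ∀ n p (f : ℕ → ℕ → ℚ) →
    sumTo n (λ m → sumTo p (f m)) ≡ sumTo p (λ j → sumTo n (λ m → f m j))
  sumTo-comm zero    p f = refl
  sumTo-comm (suc n) p f = trans (cong (_+ sumTo p (f (suc n))) (sumTo-comm n p f))
    (sym (sumTo-+ p (λ j → sumTo n (λ m → f m j)) (f (suc n))))

  sumTo-vanishing-tail : ∀ a b (f : ℕ → ℚ) → (∀ i → a < i → f i ≡ 0ℚ) → a ≤ b → sumTo b f ≡ sumTo a f
  sumTo-vanishing-tail a zero    f tail≡0 z≤n = refl
  sumTo-vanishing-tail a (suc b) f tail≡0 a≤1+b with ℕₚ.m≤n⇒m<n∨m≡n a≤1+b
  ... | inj₂ refl        = refl
  ... | inj₁ (s≤s a≤b) =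
    trans (cong₂ _+_ (sumTo-vanishing-tail a b f tail≡0 a≤b) (tail≡0 (suc b) (s≤s a≤b))) (ℚₚ.+-identityʳ _)

  δ : ℕ → ℕ → ℚ
  δ zero    zero    = 1ℚ
  δ zero    (suc j) = 0ℚ
  δ (suc n) zero    = 0ℚ
  δ (suc n) (suc j) = δ n j

  δ-diag : ∀ n → δ n n ≡ 1ℚ
  δ-diag zero    = refl
  δ-diag (suc n) = δ-diag n

  δ-< : ∀ {n j} → j < n → δ n j ≡ 0ℚ
  δ-< {suc n} {zero}  _         = refl
  δ-< {suc n} {suc j} (s≤s j<n) = δ-< j<n

  *-δ : ∀ n j (f : ℕ → ℚ) → f n * δ n j ≡ f j * δ n j
  *-δ zero    zero    f = refl
  *-δ zero    (suc j) f = trans (ℚₚ.*-zeroʳ (f 0)) (sym (ℚₚ.*-zeroʳ (f (suc j))))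
  *-δ (suc n) zero    f = trans (ℚₚ.*-zeroʳ (f (suc n))) (sym (ℚₚ.*-zeroʳ (f 0)))
  *-δ (suc n) (suc j) f = *-δ n j (λ i → f (suc i))

  sumTo-δ : ∀ n (h : ℕ → ℚ) → sumTo n (λ j → δ n j * h j) ≡ h n
  sumTo-δ zero    h = ℚₚ.*-identityˡ (h 0)
  sumTo-δ (suc n) h = trans
    (cong₂ _+_ (sumTo-zero n (λ j j≤n → trans (cong (_* h j) (δ-< (s≤s j≤n))) (ℚₚ.*-zeroˡ (h j))))
               (trans (cong (_* h (suc n)) (δ-diag n)) (ℚₚ.*-identityˡ (h (suc n)))))
    (ℚₚ.+-identityˡ (h (suc n)))

  -- Even and odd indices

  dbl : ℕ → ℕ
  dbl zero    = zero
  dbl (suc n) = suc (suc (dbl n))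

  2*≡dbl : ∀ n → 2 ℕ.* n ≡ dbl n
  2*≡dbl zero    = refl
  2*≡dbl (suc n) = trans (cong suc (ℕₚ.+-suc n (n ℕ.+ 0))) (cong (λ t → suc (suc t)) (2*≡dbl n))

  ι-dbl : ∀ n → ι (dbl n) ≡ ι n + ι n
  ι-dbl n = trans (cong ι (trans (sym (2*≡dbl n)) (cong (n ℕ.+_) (ℕₚ.+-identityʳ n)))) (ι-+ n n)

  ι-1+dbl : ∀ j → ι (suc (dbl j)) ≡ 1ℚ + (ι j + ι j)
  ι-1+dbl j = trans (ι-suc (dbl j)) (cong (_+_ 1ℚ) (ι-dbl j))

  ι-2+dbl : ∀ j → ι (suc (suc (dbl j))) ≡ 1ℚ + (1ℚ + (ι j + ι j))
  ι-2+dbl j = trans (ι-suc (suc (dbl j))) (cong (_+_ 1ℚ) (ι-1+dbl j))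

  m≤dbl : ∀ m → m ≤ dbl m
  m≤dbl zero    = z≤n
  m≤dbl (suc m) = s≤s (ℕₚ.m≤n⇒m≤1+n (m≤dbl m))

  data Parity : ℕ → Set where
    even : ∀ j → Parity (dbl j)
    odd  : ∀ j → Parity (suc (dbl j))

  parity : ∀ N → Parity N
  parity zero    = even zero
  parity (suc N) with parity N
  ... | even j = odd j
  ... | odd j  = even (suc j)

  oddSeries-odd : ∀ f j → oddSeries f (suc (dbl j)) ≡ f j
  oddSeries-odd f zero    = refl
  oddSeries-odd f (suc j) = oddSeries-odd (λ i → f (suc i)) j

  oddSeries-even : ∀ f j → oddSeries f (dbl j) ≡ 0ℚ
  oddSeries-even f zero    = refl
  oddSeries-even f (suc j) = oddSeries-even (λ i → f (suc i)) j

  -- Formal power series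

  infix  4 _≈_
  infixl 6 _⊕_
  infixl 7 _⊛_
  infixr 8 _·_
  infixr 9 x·_

  _≈_ : Series → Series → Set
  a ≈ b = ∀ N → a N ≡ b N

  _⊕_ : Series → Series → Series
  (a ⊕ b) N = a N + b N

  _·_ : ℚ → Series → Series
  (q · a) N = q * a N

  _⊛_ : Series → Series → Series
  (a ⊛ b) N = sumTo N (λ i → a i * b (N ∸ i))

  ∂ : Series → Series
  ∂ a N = ι (suc N) * a (suc N)

  𝟙 : Series
  𝟙 zero    = 1ℚ
  𝟙 (suc N) = 0ℚ

  x·_ : Series → Series
  (x· a) zero    = 0ℚ
  (x· a) (suc N) = a N

  ⊛-congˡ : ∀ {a a′} b → a ≈ a′ → a ⊛ b ≈ a′ ⊛ b
  ⊛-congˡ b a≈a′ N = sumTo-cong N (λ i _ → cong (_* b (N ∸ i)) (a≈a′ i))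

  ⊛-congʳ : ∀ a {b b′} → b ≈ b′ → a ⊛ b ≈ a ⊛ b′
  ⊛-congʳ a b≈b′ N = sumTo-cong N (λ i _ → cong (a i *_) (b≈b′ (N ∸ i)))

  ∂-cong : ∀ {a b} → a ≈ b → ∂ a ≈ ∂ b
  ∂-cong a≈b N = cong (ι (suc N) *_) (a≈b (suc N))

  x·-cong : ∀ {a b} → a ≈ b → x· a ≈ x· b
  x·-cong a≈b zero    = refl
  x·-cong a≈b (suc N) = a≈b N

  ⊛-distribˡ-⊕ : ∀ a b c → a ⊛ (b ⊕ c) ≈ a ⊛ b ⊕ a ⊛ c
  ⊛-distribˡ-⊕ a b c N = trans (sumTo-cong N (λ i _ → ℚₚ.*-distribˡ-+ (a i) _ _)) (sumTo-+ N _ _)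

  ⊛-distribʳ-⊕ : ∀ a b c → (a ⊕ b) ⊛ c ≈ a ⊛ c ⊕ b ⊛ c
  ⊛-distribʳ-⊕ a b c N =
    trans (sumTo-cong N (λ i _ → ℚₚ.*-distribʳ-+ (c (N ∸ i)) (a i) (b i))) (sumTo-+ N _ _)

  ·-⊛ : ∀ q a b → (q · a) ⊛ b ≈ q · (a ⊛ b)
  ·-⊛ q a b N = trans (sumTo-cong N (λ i _ → ℚₚ.*-assoc q _ _)) (sumTo-*ˡ N q _)

  ⊛-· : ∀ q a b → a ⊛ (q · b) ≈ q · (a ⊛ b)
  ⊛-· q a b N = trans
    (sumTo-cong N (λ i _ → solve 3 (λ x y z → x :* (y :* z) := y :* (x :* z)) refl (a i) q (b (N ∸ i))))
    (sumTo-*ˡ N q _)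

  ∂-· : ∀ q a → ∂ (q · a) ≈ q · ∂ a
  ∂-· q a N = solve 3 (λ n q x → n :* (q :* x) := q :* (n :* x)) refl (ι (suc N)) q (a (suc N))

  ∂-⊕ : ∀ a b → ∂ (a ⊕ b) ≈ ∂ a ⊕ ∂ b
  ∂-⊕ a b N = ℚₚ.*-distribˡ-+ (ι (suc N)) (a (suc N)) (b (suc N))

  ⊛-identityˡ : ∀ a → 𝟙 ⊛ a ≈ a
  ⊛-identityˡ a zero    = ℚₚ.*-identityˡ (a 0)
  ⊛-identityˡ a (suc N) = begin
    (𝟙 ⊛ a) (suc N)                                   ≡⟨ sumTo-suc N _ ⟩
    1ℚ * a (suc N) + sumTo N (λ i → 0ℚ * a (N ∸ i))  ≡⟨ cong (_+_ (1ℚ * a (suc N)))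
                                                          (sumTo-zero N (λ i _ → ℚₚ.*-zeroˡ (a (N ∸ i)))) ⟩
    1ℚ * a (suc N) + 0ℚ                               ≡⟨ ℚₚ.+-identityʳ _ ⟩
    1ℚ * a (suc N)                                    ≡⟨ ℚₚ.*-identityˡ _ ⟩
    a (suc N)                                         ∎
    where open ≡-Reasoning

  x·-⊛ : ∀ a b → (x· a) ⊛ b ≈ x· (a ⊛ b)
  x·-⊛ a b zero    = ℚₚ.*-zeroˡ (b 0)
  x·-⊛ a b (suc N) =
    trans (sumTo-suc N _) (trans (cong (_+ (a ⊛ b) N) (ℚₚ.*-zeroˡ (b (suc N)))) (ℚₚ.+-identityˡ _))

  -- Splitting the weight N + 1 = i + (N + 1 - i) on the i-th term of the Cauchy product.
  ∂-⊛ : ∀ a b → ∂ (a ⊛ b) ≈ ∂ a ⊛ b ⊕ a ⊛ ∂ b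
  ∂-⊛ a b N = begin
    ι (suc N) * sumTo (suc N) g                                       ≡⟨ sym (sumTo-*ˡ (suc N) (ι (suc N)) g) ⟩
    sumTo (suc N) (λ i → ι (suc N) * g i)                             ≡⟨ sumTo-cong (suc N) split ⟩
    sumTo (suc N) (λ i → ι i * g i + ι (suc N ∸ i) * g i)             ≡⟨ sumTo-+ (suc N) _ _ ⟩
    sumTo (suc N) (λ i → ι i * g i) + sumTo (suc N) (λ i → ι (suc N ∸ i) * g i)
                                                                      ≡⟨ cong₂ _+_ left right ⟩
    (∂ a ⊛ b) N + (a ⊛ ∂ b) N                                         ∎
    where
    open ≡-Reasoning
    g : ℕ → ℚ
    g i = a i * b (suc N ∸ i)
    split : ∀ i → i ≤ suc N → ι (suc N) * g i ≡ ι i * g i + ι (suc N ∸ i) * g i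
    split i i≤ = trans (cong (λ t → ι t * g i) (sym (ℕₚ.m+[n∸m]≡n i≤)))
      (trans (cong (_* g i) (ι-+ i (suc N ∸ i))) (ℚₚ.*-distribʳ-+ (g i) (ι i) (ι (suc N ∸ i))))
    left : sumTo (suc N) (λ i → ι i * g i) ≡ (∂ a ⊛ b) N
    left = trans (sumTo-suc N _)
      (trans (cong (_+ sumTo N (λ i → ι (suc i) * g (suc i)))
                   (trans (cong (_* g 0) ι-0) (ℚₚ.*-zeroˡ (g 0))))
      (trans (ℚₚ.+-identityˡ _)
             (sumTo-cong N (λ i _ → sym (ℚₚ.*-assoc (ι (suc i)) (a (suc i)) (b (N ∸ i)))))))
    right : sumTo (suc N) (λ i → ι (suc N ∸ i) * g i) ≡ (a ⊛ ∂ b) N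
    right = trans (cong (_+_ (sumTo N (λ i → ι (suc N ∸ i) * g i)))
        (trans (cong (λ t → ι t * g (suc N)) (ℕₚ.n∸n≡0 N))
               (trans (cong (_* g (suc N)) ι-0) (ℚₚ.*-zeroˡ (g (suc N))))))
      (trans (ℚₚ.+-identityʳ _) (sumTo-cong N (λ i i≤N → trans
        (cong (λ t → ι t * (a i * b t)) (ℕₚ.+-∸-assoc 1 i≤N))
        (solve 3 (λ x y z → x :* (y :* z) := y :* (x :* z)) refl
          (ι (suc (N ∸ i))) (a i) (b (suc (N ∸ i)))))))

  -- Series identities of positive degree are proved by comparing derivatives: ∂ is injective above degree 0.
  ⊛-comm : ∀ a b → a ⊛ b ≈ b ⊛ a
  ⊛-comm a b zero    = ℚₚ.*-comm (a 0) (b 0)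
  ⊛-comm a b (suc N) = ι-suc-cancelˡ N (begin
    ∂ (a ⊛ b) N                      ≡⟨ ∂-⊛ a b N ⟩
    (∂ a ⊛ b) N + (a ⊛ ∂ b) N        ≡⟨ cong₂ _+_ (⊛-comm (∂ a) b N) (⊛-comm a (∂ b) N) ⟩
    (b ⊛ ∂ a) N + (∂ b ⊛ a) N        ≡⟨ ℚₚ.+-comm ((b ⊛ ∂ a) N) ((∂ b ⊛ a) N) ⟩
    (∂ b ⊛ a) N + (b ⊛ ∂ a) N        ≡⟨ sym (∂-⊛ b a N) ⟩
    ∂ (b ⊛ a) N                      ∎)
    where open ≡-Reasoning

  ⊛-assoc : ∀ a b c → (a ⊛ b) ⊛ c ≈ a ⊛ (b ⊛ c)
  ⊛-assoc a b c zero    = ℚₚ.*-assoc (a 0) (b 0) (c 0)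
  ⊛-assoc a b c (suc N) = ι-suc-cancelˡ N (begin
    ∂ ((a ⊛ b) ⊛ c) N                                          ≡⟨ ∂-⊛ (a ⊛ b) c N ⟩
    (∂ (a ⊛ b) ⊛ c) N + ((a ⊛ b) ⊛ ∂ c) N                      ≡⟨ cong (_+ ((a ⊛ b) ⊛ ∂ c) N)
                                                                    (trans (⊛-congˡ c (∂-⊛ a b) N)
                                                                           (⊛-distribʳ-⊕ (∂ a ⊛ b) (a ⊛ ∂ b) c N)) ⟩
    (((∂ a ⊛ b) ⊛ c) N + ((a ⊛ ∂ b) ⊛ c) N) + ((a ⊛ b) ⊛ ∂ c) N
        ≡⟨ cong₂ _+_ (cong₂ _+_ (⊛-assoc (∂ a) b c N) (⊛-assoc a (∂ b) c N)) (⊛-assoc a b (∂ c) N) ⟩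
    ((∂ a ⊛ (b ⊛ c)) N + (a ⊛ (∂ b ⊛ c)) N) + (a ⊛ (b ⊛ ∂ c)) N
        ≡⟨ ℚₚ.+-assoc ((∂ a ⊛ (b ⊛ c)) N) _ _ ⟩
    (∂ a ⊛ (b ⊛ c)) N + ((a ⊛ (∂ b ⊛ c)) N + (a ⊛ (b ⊛ ∂ c)) N)
        ≡⟨ cong (_+_ ((∂ a ⊛ (b ⊛ c)) N))
                (sym (trans (⊛-congʳ a (∂-⊛ b c) N) (⊛-distribˡ-⊕ a (∂ b ⊛ c) (b ⊛ ∂ c) N))) ⟩
    (∂ a ⊛ (b ⊛ c)) N + (a ⊛ ∂ (b ⊛ c)) N                      ≡⟨ sym (∂-⊛ a (b ⊛ c) N) ⟩
    ∂ (a ⊛ (b ⊛ c)) N                                          ∎)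
    where open ≡-Reasoning

  ⊛-identityʳ : ∀ a → a ⊛ 𝟙 ≈ a
  ⊛-identityʳ a N = trans (⊛-comm a 𝟙 N) (⊛-identityˡ a N)

  ⊛-leftComm : ∀ a b c → a ⊛ (b ⊛ c) ≈ b ⊛ (a ⊛ c)
  ⊛-leftComm a b c N = trans (sym (⊛-assoc a b c N))
    (trans (⊛-congˡ c (⊛-comm a b) N) (⊛-assoc b a c N))

  ∂≈0⇒≈𝟙 : ∀ {f} → (∀ N → ∂ f N ≡ 0ℚ) → f 0 ≡ 1ℚ → f ≈ 𝟙
  ∂≈0⇒≈𝟙 ∂f≈0 f0≡1 zero    = f0≡1
  ∂≈0⇒≈𝟙 ∂f≈0 f0≡1 (suc N) = ι-suc-cancelˡ N (trans (∂f≈0 N) (sym (ℚₚ.*-zeroʳ (ι (suc N)))))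

  pow-zero : ∀ a → powCoeff a 0 ≈ 𝟙
  pow-zero a zero    = refl
  pow-zero a (suc N) = refl

  pow-+2 : ∀ a m → powCoeff a m ⊛ (a ⊛ a) ≈ powCoeff a (suc (suc m))
  pow-+2 a m N = trans (⊛-comm (powCoeff a m) (a ⊛ a) N) (⊛-assoc a a (powCoeff a m) N)

  ∂-pow : ∀ a m → ∂ (powCoeff a (suc m)) ≈ ι (suc m) · (powCoeff a m ⊛ ∂ a)
  ∂-pow a zero    N = begin
    ∂ (a ⊛ powCoeff a 0) N        ≡⟨ ∂-cong (λ M → trans (⊛-congʳ a (pow-zero a) M) (⊛-identityʳ a M)) N ⟩
    ∂ a N                         ≡⟨ sym (ℚₚ.*-identityˡ (∂ a N)) ⟩
    1ℚ * ∂ a N                    ≡⟨ sym (cong₂ _*_ ι-1 (trans (⊛-congˡ (∂ a) (pow-zero a) N)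
                                                               (⊛-identityˡ (∂ a) N))) ⟩
    ι 1 * (powCoeff a 0 ⊛ ∂ a) N  ∎
    where open ≡-Reasoning
  ∂-pow a (suc m) N = begin
    ∂ (a ⊛ P (suc m)) N                             ≡⟨ ∂-⊛ a (P (suc m)) N ⟩
    (∂ a ⊛ P (suc m)) N + (a ⊛ ∂ (P (suc m))) N     ≡⟨ cong₂ _+_ (⊛-comm (∂ a) (P (suc m)) N) (begin
        (a ⊛ ∂ (P (suc m))) N                             ≡⟨ ⊛-congʳ a (∂-pow a m) N ⟩
        (a ⊛ ι (suc m) · (P m ⊛ ∂ a)) N                   ≡⟨ ⊛-· (ι (suc m)) a (P m ⊛ ∂ a) N ⟩
        ι (suc m) * (a ⊛ (P m ⊛ ∂ a)) N                   ≡⟨ cong (ι (suc m) *_) (sym (⊛-assoc a (P m) (∂ a) N)) ⟩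
        ι (suc m) * M                                     ∎) ⟩
    M + ι (suc m) * M                               ≡⟨ solve 2 (λ x y → x :+ y :* x := (con 1ℚ :+ y) :* x) refl M (ι (suc m)) ⟩
    (1ℚ + ι (suc m)) * M                            ≡⟨ cong (_* M) (sym (ι-suc (suc m))) ⟩
    ι (suc (suc m)) * M                             ∎
    where
    open ≡-Reasoning
    P = powCoeff a
    M = (P (suc m) ⊛ ∂ a) N

  ∂²-pow : ∀ a m → ∂ (∂ (powCoeff a (suc (suc m)))) ≈
    ι (suc (suc m)) · (ι (suc m) · (powCoeff a m ⊛ (∂ a ⊛ ∂ a)) ⊕ powCoeff a (suc m) ⊛ ∂ (∂ a))
  ∂²-pow a m N = begin
    ∂ (∂ (P (suc (suc m)))) N                          ≡⟨ ∂-cong (∂-pow a (suc m)) N ⟩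
    ∂ (ι (suc (suc m)) · (P (suc m) ⊛ ∂ a)) N           ≡⟨ ∂-· (ι (suc (suc m))) (P (suc m) ⊛ ∂ a) N ⟩
    ι (suc (suc m)) * ∂ (P (suc m) ⊛ ∂ a) N             ≡⟨ cong (ι (suc (suc m)) *_) (∂-⊛ (P (suc m)) (∂ a) N) ⟩
    ι (suc (suc m)) * ((∂ (P (suc m)) ⊛ ∂ a) N + (P (suc m) ⊛ ∂ (∂ a)) N)
        ≡⟨ cong (λ t → ι (suc (suc m)) * (t + (P (suc m) ⊛ ∂ (∂ a)) N)) (begin
          (∂ (P (suc m)) ⊛ ∂ a) N                         ≡⟨ ⊛-congˡ (∂ a) (∂-pow a m) N ⟩
          ((ι (suc m) · (P m ⊛ ∂ a)) ⊛ ∂ a) N             ≡⟨ ·-⊛ (ι (suc m)) (P m ⊛ ∂ a) (∂ a) N ⟩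
          ι (suc m) * ((P m ⊛ ∂ a) ⊛ ∂ a) N               ≡⟨ cong (ι (suc m) *_) (⊛-assoc (P m) (∂ a) (∂ a) N) ⟩
          ι (suc m) * (P m ⊛ (∂ a ⊛ ∂ a)) N               ∎) ⟩
    ι (suc (suc m)) * (ι (suc m) * (P m ⊛ (∂ a ⊛ ∂ a)) N + (P (suc m) ⊛ ∂ (∂ a)) N)  ∎
    where
    open ≡-Reasoning
    P = powCoeff a

  -- Generalised Stirling triangles

  record IsStirlingTriangle (ρ : ℕ → ℕ → ℚ) (A : ℕ → ℕ → ℚ) : Set where
    field
      zero-zero : A 0 0 ≡ 1ℚ
      zero-suc  : ∀ m → A 0 (suc m) ≡ 0ℚ
      suc-zero  : ∀ n → A (suc n) 0 ≡ 0ℚ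
      suc-suc   : ∀ n m → A (suc n) (suc m) ≡ A n m + ρ n m * A n (suc m)

    zero-row : ∀ j → A 0 j ≡ δ 0 j
    zero-row zero    = zero-zero
    zero-row (suc j) = zero-suc j

    above-diagonal : ∀ {n m} → n < m → A n m ≡ 0ℚ
    above-diagonal {zero}  {suc m} _         = zero-suc m
    above-diagonal {suc n} {suc m} (s≤s n<m) = begin
      A (suc n) (suc m)                ≡⟨ suc-suc n m ⟩
      A n m + ρ n m * A n (suc m)      ≡⟨ cong₂ (λ x y → x + ρ n m * y)
                                            (above-diagonal n<m) (above-diagonal (ℕₚ.m<n⇒m<1+n n<m)) ⟩
      0ℚ + ρ n m * 0ℚ                  ≡⟨ trans (ℚₚ.+-identityˡ _) (ℚₚ.*-zeroʳ (ρ n m)) ⟩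
      0ℚ                               ∎
      where open ≡-Reasoning

  open IsStirlingTriangle

  -- Weights depending on the row give generalised Stirling numbers of the first kind, weights depending
  -- on the column those of the second kind; each kind is inverted by the other kind with negated weights.
  module _ (α : ℕ → ℚ) (α-0 : α 0 ≡ 0ℚ) {A B : ℕ → ℕ → ℚ}
           (A-tri : IsStirlingTriangle (λ n _ → α n) A)
           (B-tri : IsStirlingTriangle (λ _ j → - α (suc j)) B) where

    weightedStirling₁-inverse : ∀ n j → sumTo n (λ m → A n m * B m j) ≡ δ n j
    weightedStirling₁-inverse zero    j =
      trans (cong₂ _*_ (zero-zero A-tri) (zero-row B-tri j)) (ℚₚ.*-identityˡ (δ 0 j))
    weightedStirling₁-inverse (suc n) j = begin
      sumTo (suc n) (λ m → A (suc n) m * B m j)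
          ≡⟨ sumTo-suc n _ ⟩
      A (suc n) 0 * B 0 j + sumTo n (λ m → A (suc n) (suc m) * B (suc m) j)
          ≡⟨ cong₂ _+_ (trans (cong (_* B 0 j) (suc-zero A-tri n)) (ℚₚ.*-zeroˡ (B 0 j)))
                       (sumTo-cong n (λ m _ → expand m)) ⟩
      0ℚ + sumTo n (λ m → A n m * B (suc m) j + α n * g (suc m))
          ≡⟨ trans (ℚₚ.+-identityˡ _) (trans (sumTo-+ n _ _) (cong (_+_ S) (sumTo-*ˡ n (α n) _))) ⟩
      S + α n * sumTo n (λ m → g (suc m))
          ≡⟨ cong (λ t → S + α n * t) shifted ⟩
      S + α n * (δ n j + - (A n 0 * B 0 j))
          ≡⟨ cong (_+_ S) (solve 4 (λ a d x y → a :* (d :+ :- (x :* y)) := a :* d :+ :- ((a :* x) :* y))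
                            refl (α n) (δ n j) (A n 0) (B 0 j)) ⟩
      S + (α n * δ n j + - ((α n * A n 0) * B 0 j))
          ≡⟨ cong (λ t → S + (α n * δ n j + - (t * B 0 j))) (α*A-0 n) ⟩
      S + (α n * δ n j + - (0ℚ * B 0 j))
          ≡⟨ cong (_+_ S) (solve 2 (λ x y → x :+ :- (con 0ℚ :* y) := x) refl (α n * δ n j) (B 0 j)) ⟩
      S + α n * δ n j
          ≡⟨ last-step j ⟩
      δ (suc n) j ∎
      where
      open ≡-Reasoning
      g : ℕ → ℚ
      g m = A n m * B m j
      S = sumTo n (λ m → A n m * B (suc m) j)
      expand : ∀ m → A (suc n) (suc m) * B (suc m) j ≡ A n m * B (suc m) j + α n * g (suc m)
      expand m = trans (cong (_* B (suc m) j) (suc-suc A-tri n m))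
        (solve 4 (λ a σ b t → (a :+ σ :* b) :* t := a :* t :+ σ :* (b :* t)) refl
          (A n m) (α n) (A n (suc m)) (B (suc m) j))
      α*A-0 : ∀ n → α n * A n 0 ≡ 0ℚ
      α*A-0 zero    = trans (cong (_* A 0 0) α-0) (ℚₚ.*-zeroˡ (A 0 0))
      α*A-0 (suc n) = trans (cong (α (suc n) *_) (suc-zero A-tri n)) (ℚₚ.*-zeroʳ (α (suc n)))
      shifted : sumTo n (λ m → g (suc m)) ≡ δ n j + - g 0
      shifted = trans (sumTo-∘suc n g) (cong (_+ - g 0) (trans
        (cong₂ _+_ (weightedStirling₁-inverse n j)
                   (trans (cong (_* B (suc n) j) (above-diagonal A-tri (ℕₚ.n<1+n n))) (ℚₚ.*-zeroˡ (B (suc n) j))))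
        (ℚₚ.+-identityʳ (δ n j))))
      last-step : ∀ j → sumTo n (λ m → A n m * B (suc m) j) + α n * δ n j ≡ δ (suc n) j
      last-step zero = trans
        (cong₂ _+_ (sumTo-zero n (λ m _ → trans (cong (A n m *_) (suc-zero B-tri m)) (ℚₚ.*-zeroʳ (A n m))))
                   (trans (*-δ n 0 α) (trans (cong (_* δ n 0) α-0) (ℚₚ.*-zeroˡ (δ n 0)))))
        (ℚₚ.+-identityˡ 0ℚ)
      last-step (suc j) = begin
        sumTo n (λ m → A n m * B (suc m) (suc j)) + α n * δ n (suc j)
            ≡⟨ cong₂ _+_ (sumTo-cong n (λ m _ → trans (cong (A n m *_) (suc-suc B-tri m j))
                   (solve 4 (λ a x t y → a :* (x :+ t :* y) := a :* x :+ t :* (a :* y)) refl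
                     (A n m) (B m j) (- α (suc j)) (B m (suc j)))))
                 (*-δ n (suc j) α) ⟩
        sumTo n (λ m → A n m * B m j + - α (suc j) * (A n m * B m (suc j))) + α (suc j) * δ n (suc j)
            ≡⟨ cong (_+ α (suc j) * δ n (suc j)) (trans (sumTo-+ n _ _)
                 (cong₂ _+_ (weightedStirling₁-inverse n j)
                   (trans (sumTo-*ˡ n (- α (suc j)) _) (cong (- α (suc j) *_) (weightedStirling₁-inverse n (suc j)))))) ⟩
        (δ n j + - α (suc j) * δ n (suc j)) + α (suc j) * δ n (suc j)
            ≡⟨ solve 3 (λ a t b → (a :+ (:- t) :* b) :+ t :* b := a) refl (δ n j) (α (suc j)) (δ n (suc j)) ⟩
        δ n j ∎

  module _ (β : ℕ → ℚ) (β-0 : β 0 ≡ 0ℚ) {A B : ℕ → ℕ → ℚ}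
           (A-tri : IsStirlingTriangle (λ _ m → β (suc m)) A)
           (B-tri : IsStirlingTriangle (λ m _ → - β m) B) where

    weightedStirling₂-inverse : ∀ n j → sumTo n (λ m → A n m * B m j) ≡ δ n j
    weightedStirling₂-inverse zero    j =
      trans (cong₂ _*_ (zero-zero A-tri) (zero-row B-tri j)) (ℚₚ.*-identityˡ (δ 0 j))
    weightedStirling₂-inverse (suc n) j = begin
      sumTo (suc n) (λ m → A (suc n) m * B m j)
          ≡⟨ sumTo-suc n _ ⟩
      A (suc n) 0 * B 0 j + sumTo n (λ m → A (suc n) (suc m) * B (suc m) j)
          ≡⟨ cong₂ _+_ (trans (cong (_* B 0 j) (suc-zero A-tri n)) (ℚₚ.*-zeroˡ (B 0 j)))
                       (sumTo-cong n (λ m _ → expand m)) ⟩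
      0ℚ + sumTo n (λ m → A n m * B (suc m) j + h (suc m))
          ≡⟨ trans (ℚₚ.+-identityˡ _) (sumTo-+ n _ _) ⟩
      S + sumTo n (λ m → h (suc m))
          ≡⟨ cong (_+_ S) shifted ⟩
      S + sumTo n h
          ≡⟨ last-step j ⟩
      δ (suc n) j ∎
      where
      open ≡-Reasoning
      h : ℕ → ℚ
      h m = β m * (A n m * B m j)
      S = sumTo n (λ m → A n m * B (suc m) j)
      expand : ∀ m → A (suc n) (suc m) * B (suc m) j ≡ A n m * B (suc m) j + h (suc m)
      expand m = trans (cong (_* B (suc m) j) (suc-suc A-tri n m))
        (solve 4 (λ a k b u → (a :+ k :* b) :* u := a :* u :+ k :* (b :* u)) refl
          (A n m) (β (suc m)) (A n (suc m)) (B (suc m) j))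
      shifted : sumTo n (λ m → h (suc m)) ≡ sumTo n h
      shifted = begin
        sumTo n (λ m → h (suc m))                                    ≡⟨ sumTo-∘suc n h ⟩
        (sumTo n h + β (suc n) * (A n (suc n) * B (suc n) j)) + - h 0
            ≡⟨ cong₂ (λ x y → (sumTo n h + β (suc n) * (x * B (suc n) j)) + - (y * (A n 0 * B 0 j)))
                     (above-diagonal A-tri (ℕₚ.n<1+n n)) β-0 ⟩
        (sumTo n h + β (suc n) * (0ℚ * B (suc n) j)) + - (0ℚ * (A n 0 * B 0 j))
            ≡⟨ solve 4 (λ s b x y → (s :+ b :* (con 0ℚ :* x)) :+ :- (con 0ℚ :* y) := s) refl
                 (sumTo n h) (β (suc n)) (B (suc n) j) (A n 0 * B 0 j) ⟩
        sumTo n h                                                    ∎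
      last-step : ∀ j → sumTo n (λ m → A n m * B (suc m) j) + sumTo n (λ m → β m * (A n m * B m j)) ≡ δ (suc n) j
      last-step zero = trans
        (cong₂ _+_ (sumTo-zero n (λ m _ → trans (cong (A n m *_) (suc-zero B-tri m)) (ℚₚ.*-zeroʳ (A n m))))
                   (sumTo-zero n β*A*B-0))
        (ℚₚ.+-identityˡ 0ℚ)
        where
        β*A*B-0 : ∀ m → m ≤ n → β m * (A n m * B m 0) ≡ 0ℚ
        β*A*B-0 zero    _ = trans (cong (_* (A n 0 * B 0 0)) β-0) (ℚₚ.*-zeroˡ (A n 0 * B 0 0))
        β*A*B-0 (suc m) _ = trans (cong (λ x → β (suc m) * (A n (suc m) * x)) (suc-zero B-tri m))
          (solve 2 (λ b a → b :* (a :* con 0ℚ) := con 0ℚ) refl (β (suc m)) (A n (suc m)))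
      last-step (suc j) = begin
        sumTo n (λ m → A n m * B (suc m) (suc j)) + sumTo n (λ m → β m * (A n m * B m (suc j)))
            ≡⟨ sym (sumTo-+ n _ _) ⟩
        sumTo n (λ m → A n m * B (suc m) (suc j) + β m * (A n m * B m (suc j)))
            ≡⟨ sumTo-cong n (λ m _ → trans (cong (λ x → A n m * x + β m * (A n m * B m (suc j))) (suc-suc B-tri m j))
                 (solve 4 (λ a x k y → a :* (x :+ (:- k) :* y) :+ k :* (a :* y) := a :* x) refl
                   (A n m) (B m j) (β m) (B m (suc j)))) ⟩
        sumTo n (λ m → A n m * B m j)
            ≡⟨ weightedStirling₂-inverse n j ⟩
        δ n j ∎

  sumTo-inversion : ∀ n (A : ℕ → ℚ) (B : ℕ → ℕ → ℚ) (h : ℕ → ℚ) (u : ℕ → ℕ) → (∀ m → m ≤ u m) →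
    (∀ j → sumTo n (λ m → A m * B m j) ≡ δ n j) → (∀ {m j} → m < j → B m j ≡ 0ℚ) →
    sumTo n (λ m → A m * sumTo (u m) (λ j → B m j * h j)) ≡ h n
  sumTo-inversion n A B h u m≤u inverse upper = begin
    sumTo n (λ m → A m * sumTo (u m) (λ j → B m j * h j))
        ≡⟨ sumTo-cong n (λ m m≤n → cong (A m *_) (trans (sumTo-vanishing-tail m (u m) _ (Bh-upper m) (m≤u m))
                                                         (sym (sumTo-vanishing-tail m n _ (Bh-upper m) m≤n)))) ⟩
    sumTo n (λ m → A m * sumTo n (λ j → B m j * h j))
        ≡⟨ sumTo-cong n (λ m _ → sym (sumTo-*ˡ n (A m) _)) ⟩
    sumTo n (λ m → sumTo n (λ j → A m * (B m j * h j)))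
        ≡⟨ sumTo-comm n n _ ⟩
    sumTo n (λ j → sumTo n (λ m → A m * (B m j * h j)))
        ≡⟨ sumTo-cong n (λ j _ → begin
             sumTo n (λ m → A m * (B m j * h j))   ≡⟨ sumTo-cong n (λ m _ → solve 3 (λ a b x → a :* (b :* x) := x :* (a :* b))
                                                          refl (A m) (B m j) (h j)) ⟩
             sumTo n (λ m → h j * (A m * B m j))   ≡⟨ sumTo-*ˡ n (h j) _ ⟩
             h j * sumTo n (λ m → A m * B m j)     ≡⟨ cong (h j *_) (inverse j) ⟩
             h j * δ n j                           ≡⟨ ℚₚ.*-comm (h j) (δ n j) ⟩
             δ n j * h j                           ∎) ⟩
    sumTo n (λ j → δ n j * h j)
        ≡⟨ sumTo-δ n h ⟩
    h n ∎
    where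
    open ≡-Reasoning
    Bh-upper : ∀ m j → m < j → B m j * h j ≡ 0ℚ
    Bh-upper m j m<j = trans (cong (_* h j) (upper m<j)) (ℚₚ.*-zeroˡ (h j))

  evenPowerCoeff : Series → ℕ → ℕ → ℚ
  evenPowerCoeff a m j = ι (dbl m !) * powCoeff a (dbl j) (dbl m) * inv! (dbl j)

  EvenPowerRecurrence : Series → (ℕ → ℕ → ℚ) → Set
  EvenPowerRecurrence a ρ = ∀ m j →
    ∂ (∂ (powCoeff a (dbl (suc j)))) (dbl m)
      ≡ ι (suc (suc (dbl j))) * (ι (suc (dbl j)) * powCoeff a (dbl j) (dbl m)) + ρ m j * powCoeff a (dbl (suc j)) (dbl m)

  evenPowerCoeff-triangle : ∀ a ρ → a 0 ≡ 0ℚ → EvenPowerRecurrence a ρ → IsStirlingTriangle ρ (evenPowerCoeff a)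
  evenPowerCoeff-triangle a ρ a0≡0 recurrence = record
    { zero-zero = cong (λ t → t * 1ℚ * inv! 0) ι-1
    ; zero-suc  = λ j → trans (cong (λ t → ι 1 * t * inv! (dbl (suc j)))
                                    (trans (cong (_* powCoeff a (suc (dbl j)) 0) a0≡0) (ℚₚ.*-zeroˡ (powCoeff a (suc (dbl j)) 0))))
                              (trans (cong (_* inv! (dbl (suc j))) (ℚₚ.*-zeroʳ (ι 1))) (ℚₚ.*-zeroˡ (inv! (dbl (suc j)))))
    ; suc-zero  = λ m → trans (cong (_* inv! 0) (ℚₚ.*-zeroʳ (ι (dbl (suc m) !)))) (ℚₚ.*-zeroˡ (inv! 0))
    ; suc-suc   = rescale
    }
    where
    rescale : ∀ m j → evenPowerCoeff a (suc m) (suc j) ≡ evenPowerCoeff a m j + ρ m j * evenPowerCoeff a m (suc j)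
    rescale m j = begin
      ι (suc (suc M) !) * C * G
          ≡⟨ cong (λ t → t * C * G) (trans (ι-! (suc M)) (cong (ι (suc (suc M)) *_) (ι-! M))) ⟩
      (ι (suc (suc M)) * (ι (suc M) * F)) * C * G
          ≡⟨ solve 5 (λ a b f x g → (a :* (b :* f)) :* x :* g := f :* g :* (b :* (a :* x))) refl
               (ι (suc (suc M))) (ι (suc M)) F C G ⟩
      F * G * (ι (suc M) * (ι (suc (suc M)) * C))
          ≡⟨ cong (F * G *_) (recurrence m j) ⟩
      F * G * (ι (suc (suc J)) * (ι (suc J) * A) + ρ m j * B)
          ≡⟨ solve 7 (λ f g a b x y t → f :* g :* (x :* (y :* a) :+ t :* b)
                                      := f :* a :* (g :* (x :* y)) :+ t :* (f :* b :* g)) refl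
               F G A B (ι (suc (suc J))) (ι (suc J)) (ρ m j) ⟩
      F * A * (G * (ι (suc (suc J)) * ι (suc J))) + ρ m j * (F * B * G)
          ≡⟨ cong (λ t → F * A * t + ρ m j * (F * B * G)) (inv!-suc-suc J) ⟩
      F * A * inv! J + ρ m j * (F * B * G) ∎
      where
      open ≡-Reasoning
      M = dbl m
      J = dbl j
      F = ι (M !)
      G = inv! (suc (suc J))
      A = powCoeff a J M
      B = powCoeff a (suc (suc J)) M
      C = powCoeff a (suc (suc J)) (suc (suc M))

  -- The series 2 sin(x/2)

  twoSinHalf-odd : ∀ j → twoSinHalf (suc (dbl j)) ≡ sign j * (recip4^ j * inv! (suc (dbl j)))
  twoSinHalf-odd j = trans (oddSeries-odd (λ i → sign i * (recip4^ i * inv! (suc (2 ℕ.* i)))) j)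
    (cong (λ t → sign j * (recip4^ j * inv! (suc t))) (2*≡dbl j))

  twoSinHalf-even : ∀ j → twoSinHalf (dbl j) ≡ 0ℚ
  twoSinHalf-even = oddSeries-even (λ i → sign i * (recip4^ i * inv! (suc (2 ℕ.* i))))

  ∂²-twoSinHalf : ∂ (∂ twoSinHalf) ≈ (- ¼) · twoSinHalf
  ∂²-twoSinHalf N = by-parity (parity N)
    where
    by-parity : ∀ {N} → Parity N → ∂ (∂ twoSinHalf) N ≡ (- ¼) * twoSinHalf N
    by-parity (even j) = begin
      ι (suc (dbl j)) * (ι (suc (suc (dbl j))) * twoSinHalf (dbl (suc j)))
          ≡⟨ cong (λ t → ι (suc (dbl j)) * (ι (suc (suc (dbl j))) * t)) (twoSinHalf-even (suc j)) ⟩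
      ι (suc (dbl j)) * (ι (suc (suc (dbl j))) * 0ℚ)
          ≡⟨ solve 3 (λ a b q → a :* (b :* con 0ℚ) := q :* con 0ℚ) refl (ι (suc (dbl j))) (ι (suc (suc (dbl j)))) (- ¼) ⟩
      (- ¼) * 0ℚ
          ≡⟨ cong ((- ¼) *_) (sym (twoSinHalf-even j)) ⟩
      (- ¼) * twoSinHalf (dbl j) ∎
      where open ≡-Reasoning
    by-parity (odd j) = begin
      ι (suc (suc J)) * (ι (suc (suc (suc J))) * twoSinHalf (suc (dbl (suc j))))
          ≡⟨ cong (λ t → ι (suc (suc J)) * (ι (suc (suc (suc J))) * t))
                  (trans (twoSinHalf-odd (suc j)) (cong (λ t → - sign j * (t * inv! (suc (suc (suc J))))) (recip4^-suc j))) ⟩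
      ι (suc (suc J)) * (ι (suc (suc (suc J))) * (- sign j * ((¼ * recip4^ j) * inv! (suc (suc (suc J))))))
          ≡⟨ solve 6 (λ a b σ q r g → a :* (b :* (:- σ :* ((q :* r) :* g))) := (:- q) :* (σ :* (r :* (g :* (b :* a))))) refl
               (ι (suc (suc J))) (ι (suc (suc (suc J)))) (sign j) ¼ (recip4^ j) (inv! (suc (suc (suc J)))) ⟩
      (- ¼) * (sign j * (recip4^ j * (inv! (suc (suc (suc J))) * (ι (suc (suc (suc J))) * ι (suc (suc J))))))
          ≡⟨ cong (λ t → (- ¼) * (sign j * (recip4^ j * t))) (inv!-suc-suc (suc J)) ⟩
      (- ¼) * (sign j * (recip4^ j * inv! (suc J)))
          ≡⟨ cong ((- ¼) *_) (sym (twoSinHalf-odd j)) ⟩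
      (- ¼) * twoSinHalf (suc J) ∎
      where
      open ≡-Reasoning
      J = dbl j

  -- The derivative vanishes because s″ = -¼ s.
  twoSinHalf-pythagoras : ∂ twoSinHalf ⊛ ∂ twoSinHalf ⊕ ¼ · (twoSinHalf ⊛ twoSinHalf) ≈ 𝟙
  twoSinHalf-pythagoras = ∂≈0⇒≈𝟙 ∂≈0 (trans (cong₂ (λ x y → x * y + ¼ * (s 0 * s 0)) c0≡1 c0≡1) refl)
    where
    s = twoSinHalf
    c = ∂ twoSinHalf
    c0≡1 : c 0 ≡ 1ℚ
    c0≡1 = trans (cong (_* s 1) ι-1) refl
    ∂≈0 : ∀ N → ∂ (c ⊛ c ⊕ ¼ · (s ⊛ s)) N ≡ 0ℚ
    ∂≈0 N = begin
      ∂ (c ⊛ c ⊕ ¼ · (s ⊛ s)) N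
          ≡⟨ trans (∂-⊕ (c ⊛ c) (¼ · (s ⊛ s)) N) (cong (_+_ (∂ (c ⊛ c) N)) (∂-· ¼ (s ⊛ s) N)) ⟩
      ∂ (c ⊛ c) N + ¼ * ∂ (s ⊛ s) N
          ≡⟨ cong₂ (λ u v → u + ¼ * v) (∂-⊛ c c N) (∂-⊛ s s N) ⟩
      ((∂ c ⊛ c) N + (c ⊛ ∂ c) N) + ¼ * ((c ⊛ s) N + (s ⊛ c) N)
          ≡⟨ cong (λ u → u + ¼ * ((c ⊛ s) N + (s ⊛ c) N))
               (cong₂ _+_ (trans (⊛-congˡ c ∂²-twoSinHalf N) (·-⊛ (- ¼) s c N))
                          (trans (⊛-congʳ c ∂²-twoSinHalf N) (⊛-· (- ¼) c s N))) ⟩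
      ((- ¼) * (s ⊛ c) N + (- ¼) * (c ⊛ s) N) + ¼ * ((c ⊛ s) N + (s ⊛ c) N)
          ≡⟨ solve 3 (λ q x y → ((:- q) :* x :+ (:- q) :* y) :+ q :* (y :+ x) := con 0ℚ) refl ¼ ((s ⊛ c) N) ((c ⊛ s) N) ⟩
      0ℚ ∎
      where open ≡-Reasoning

  ∂²-twoSinHalf-pow : ∀ m → ∂ (∂ (powCoeff twoSinHalf (suc (suc m)))) ≈
    ι (suc (suc m)) · (ι (suc m) · (powCoeff twoSinHalf m ⊕ (- ¼) · powCoeff twoSinHalf (suc (suc m)))
                       ⊕ (- ¼) · powCoeff twoSinHalf (suc (suc m)))
  ∂²-twoSinHalf-pow m N = begin
    ∂ (∂ (P (suc (suc m)))) N
        ≡⟨ ∂²-pow s m N ⟩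
    ι (suc (suc m)) * (ι (suc m) * (P m ⊛ (∂ s ⊛ ∂ s)) N + (P (suc m) ⊛ ∂ (∂ s)) N)
        ≡⟨ cong₂ (λ x y → ι (suc (suc m)) * (ι (suc m) * x + y)) c²-part s″-part ⟩
    ι (suc (suc m)) * (ι (suc m) * (P m N + (- ¼) * P (suc (suc m)) N) + (- ¼) * P (suc (suc m)) N) ∎
    where
    open ≡-Reasoning
    s = twoSinHalf
    P = powCoeff s
    ∂s² : ∂ s ⊛ ∂ s ≈ 𝟙 ⊕ (- ¼) · (s ⊛ s)
    ∂s² M = trans (solve 3 (λ x q y → x := (x :+ q :* y) :+ (:- q) :* y) refl ((∂ s ⊛ ∂ s) M) ¼ ((s ⊛ s) M))
      (cong (_+ (- ¼) * (s ⊛ s) M) (twoSinHalf-pythagoras M))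
    c²-part : (P m ⊛ (∂ s ⊛ ∂ s)) N ≡ P m N + (- ¼) * P (suc (suc m)) N
    c²-part = begin
      (P m ⊛ (∂ s ⊛ ∂ s)) N                              ≡⟨ ⊛-congʳ (P m) ∂s² N ⟩
      (P m ⊛ (𝟙 ⊕ (- ¼) · (s ⊛ s))) N                    ≡⟨ ⊛-distribˡ-⊕ (P m) 𝟙 ((- ¼) · (s ⊛ s)) N ⟩
      (P m ⊛ 𝟙) N + (P m ⊛ (- ¼) · (s ⊛ s)) N            ≡⟨ cong₂ _+_ (⊛-identityʳ (P m) N)
                                                             (trans (⊛-· (- ¼) (P m) (s ⊛ s) N) (cong ((- ¼) *_) (pow-+2 s m N))) ⟩
      P m N + (- ¼) * P (suc (suc m)) N                  ∎
    s″-part : (P (suc m) ⊛ ∂ (∂ s)) N ≡ (- ¼) * P (suc (suc m)) N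
    s″-part = trans (⊛-congʳ (P (suc m)) ∂²-twoSinHalf N)
      (trans (⊛-· (- ¼) (P (suc m)) s N) (cong ((- ¼) *_) (⊛-comm (P (suc m)) s N)))

  twoSinHalf-triangle : IsStirlingTriangle (λ _ j → - ι (suc j ℕ.* suc j)) (evenPowerCoeff twoSinHalf)
  twoSinHalf-triangle = evenPowerCoeff-triangle twoSinHalf _ refl recurrence
    where
    recurrence : EvenPowerRecurrence twoSinHalf (λ _ j → - ι (suc j ℕ.* suc j))
    recurrence m j = begin
      ∂ (∂ (P (suc (suc J)))) (dbl m)
          ≡⟨ ∂²-twoSinHalf-pow J (dbl m) ⟩
      ι (suc (suc J)) * (ι (suc J) * (A + (- ¼) * B) + (- ¼) * B)
          ≡⟨ cong₂ (λ x y → x * (y * (A + (- ¼) * B) + (- ¼) * B)) (ι-2+dbl j) (ι-1+dbl j) ⟩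
      (1ℚ + (1ℚ + (u + u))) * ((1ℚ + (u + u)) * (A + (- ¼) * B) + (- ¼) * B)
          ≡⟨ solve 3 (λ u a b → let p = con 1ℚ :+ (u :+ u); q = con 1ℚ :+ p; j+1 = con 1ℚ :+ u in
                       q :* (p :* (a :+ (:- con ¼) :* b) :+ (:- con ¼) :* b) := q :* (p :* a) :+ (:- (j+1 :* j+1)) :* b)
               refl u A B ⟩
      (1ℚ + (1ℚ + (u + u))) * ((1ℚ + (u + u)) * A) + (- ((1ℚ + u) * (1ℚ + u))) * B
          ≡⟨ cong₂ (λ x y → x * (y * A) + (- ((1ℚ + u) * (1ℚ + u))) * B) (sym (ι-2+dbl j)) (sym (ι-1+dbl j)) ⟩
      ι (suc (suc J)) * (ι (suc J) * A) + (- ((1ℚ + u) * (1ℚ + u))) * B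
          ≡⟨ cong (λ t → ι (suc (suc J)) * (ι (suc J) * A) + (- t) * B)
                  (sym (trans (ι-* (suc j) (suc j)) (cong₂ _*_ (ι-suc j) (ι-suc j)))) ⟩
      ι (suc (suc J)) * (ι (suc J) * A) + (- ι (suc j ℕ.* suc j)) * B ∎
      where
      open ≡-Reasoning
      P = powCoeff twoSinHalf
      J = dbl j
      u = ι j
      A = P J (dbl m)
      B = P (suc (suc J)) (dbl m)

  -- The series arcsinh x

  𝕩 : Series
  𝕩 = x· 𝟙

  1+𝕩² : Series
  1+𝕩² = 𝟙 ⊕ x· 𝕩

  𝕩-⊛ : ∀ f → 𝕩 ⊛ f ≈ x· f
  𝕩-⊛ f N = trans (x·-⊛ 𝟙 f N) (x·-cong (⊛-identityˡ f) N)

  1+𝕩²-⊛ : ∀ f → 1+𝕩² ⊛ f ≈ f ⊕ x· x· f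
  1+𝕩²-⊛ f N = trans (⊛-distribʳ-⊕ 𝟙 (x· 𝕩) f N)
    (cong₂ _+_ (⊛-identityˡ f N) (trans (x·-⊛ 𝕩 f N) (x·-cong (𝕩-⊛ f) N)))

  ∂-1+𝕩² : ∂ 1+𝕩² ≈ ι 2 · 𝕩
  ∂-1+𝕩² zero          = trans (cong (ι 1 *_) (ℚₚ.+-identityˡ 0ℚ))
    (trans (ℚₚ.*-zeroʳ (ι 1)) (sym (ℚₚ.*-zeroʳ (ι 2))))
  ∂-1+𝕩² (suc zero)    = refl
  ∂-1+𝕩² (suc (suc N)) = trans (cong (ι (suc (suc (suc N))) *_) (ℚₚ.+-identityˡ 0ℚ))
    (trans (ℚₚ.*-zeroʳ (ι (suc (suc (suc N))))) (sym (ℚₚ.*-zeroʳ (ι 2))))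

  coeff-1+𝕩²∂²+𝕩∂ : ∀ f N → (1+𝕩² ⊛ ∂ (∂ f) ⊕ 𝕩 ⊛ ∂ f) N ≡ ∂ (∂ f) N + ι (N ℕ.* N) * f N
  coeff-1+𝕩²∂²+𝕩∂ f N = trans (cong₂ _+_ (1+𝕩²-⊛ (∂ (∂ f)) N) (𝕩-⊛ (∂ f) N)) (by-degree N)
    where
    by-degree : ∀ N → (∂ (∂ f) N + (x· x· ∂ (∂ f)) N) + (x· ∂ f) N ≡ ∂ (∂ f) N + ι (N ℕ.* N) * f N
    by-degree zero = begin
      (∂ (∂ f) 0 + 0ℚ) + 0ℚ     ≡⟨ trans (ℚₚ.+-identityʳ _) (ℚₚ.+-identityʳ _) ⟩
      ∂ (∂ f) 0                 ≡⟨ sym (ℚₚ.+-identityʳ _) ⟩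
      ∂ (∂ f) 0 + 0ℚ            ≡⟨ cong (_+_ (∂ (∂ f) 0)) (sym (trans (cong (_* f 0) ι-0) (ℚₚ.*-zeroˡ (f 0)))) ⟩
      ∂ (∂ f) 0 + ι 0 * f 0     ∎
      where open ≡-Reasoning
    by-degree (suc zero) = cong (_+ ι 1 * f 1) (ℚₚ.+-identityʳ (∂ (∂ f) 1))
    by-degree (suc (suc K)) = begin
      (a + ι (suc K) * (y * b)) + y * b   ≡⟨ cong (λ t → (a + ι (suc K) * (t * b)) + t * b) (ι-suc (suc K)) ⟩
      (a + ι (suc K) * ((1ℚ + ι (suc K)) * b)) + (1ℚ + ι (suc K)) * b
          ≡⟨ solve 3 (λ a x b → (a :+ x :* ((con 1ℚ :+ x) :* b)) :+ (con 1ℚ :+ x) :* b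
                              := a :+ ((con 1ℚ :+ x) :* (con 1ℚ :+ x)) :* b) refl a (ι (suc K)) b ⟩
      a + ((1ℚ + ι (suc K)) * (1ℚ + ι (suc K))) * b
          ≡⟨ cong (λ t → a + t * b)
                  (sym (trans (ι-* (suc (suc K)) (suc (suc K))) (cong₂ _*_ (ι-suc (suc K)) (ι-suc (suc K))))) ⟩
      a + ι (suc (suc K) ℕ.* suc (suc K)) * b ∎
      where
      open ≡-Reasoning
      a = ∂ (∂ f) (suc (suc K))
      b = f (suc (suc K))
      y = ι (suc (suc K))

  arcsinhCoeff : ℕ → ℚ
  arcsinhCoeff i = sign i * (ℕ→ℚ ((2 ℕ.* i) !) * (recip4^ i * (inv! i * (inv! i * invPowℤ (2 ℕ.* i) (+ 1)))))

  arcsinhS-odd : ∀ j → arcsinhS (suc (dbl j)) ≡ sign j * (ι (dbl j !) * (recip4^ j * (inv! j * (inv! j * invPowℤ (dbl j) (+ 1)))))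
  arcsinhS-odd j = trans (oddSeries-odd arcsinhCoeff j) (trans
    (cong (λ t → sign j * (ℕ→ℚ (t !) * (recip4^ j * (inv! j * (inv! j * invPowℤ t (+ 1)))))) (2*≡dbl j))
    (cong (λ t → sign j * (t * (recip4^ j * (inv! j * (inv! j * invPowℤ (dbl j) (+ 1)))))) (sym (ι-def (dbl j !)))))

  ∂arcsinhS-even : ∀ j → ∂ arcsinhS (dbl j) ≡ sign j * (ι (dbl j !) * (recip4^ j * (inv! j * inv! j)))
  ∂arcsinhS-even j = begin
    ι (suc J) * arcsinhS (suc J)                    ≡⟨ cong (ι (suc J) *_) (arcsinhS-odd j) ⟩
    ι (suc J) * (σ * (F * (R * (I * (I * V)))))     ≡⟨ solve 6 (λ a σ f r i v → a :* (σ :* (f :* (r :* (i :* (i :* v)))))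
                                                                := (σ :* (f :* (r :* (i :* i)))) :* (v :* a))
                                                         refl (ι (suc J)) σ F R I V ⟩
    (σ * (F * (R * (I * I)))) * (V * ι (suc J))     ≡⟨ cong ((σ * (F * (R * (I * I)))) *_) (invPowℤ-1-*-ι J) ⟩
    (σ * (F * (R * (I * I)))) * 1ℚ                  ≡⟨ ℚₚ.*-identityʳ _ ⟩
    σ * (F * (R * (I * I)))                         ∎
    where
    open ≡-Reasoning
    J = dbl j
    σ = sign j
    F = ι (J !)
    R = recip4^ j
    I = inv! j
    V = invPowℤ J (+ 1)

  ∂arcsinhS-odd : ∀ j → ∂ arcsinhS (suc (dbl j)) ≡ 0ℚ
  ∂arcsinhS-odd j = trans (cong (ι (suc (suc (dbl j))) *_) (oddSeries-even arcsinhCoeff (suc j)))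
    (ℚₚ.*-zeroʳ (ι (suc (suc (dbl j)))))

  ∂arcsinhS-step : ∀ j → ι (suc (suc (dbl j))) * ∂ arcsinhS (dbl (suc j)) ≡ - ι (suc (dbl j)) * ∂ arcsinhS (dbl j)
  ∂arcsinhS-step j = begin
    ι (suc (suc J)) * E (dbl (suc j))
        ≡⟨ cong (ι (suc (suc J)) *_) (∂arcsinhS-even (suc j)) ⟩
    ι (suc (suc J)) * (- sign j * (ι (suc (suc J) !) * (recip4^ (suc j) * (I * I))))
        ≡⟨ cong₂ (λ x y → ι (suc (suc J)) * (- sign j * (x * (y * (I * I)))))
                 (trans (ι-! (suc J)) (cong (ι (suc (suc J)) *_) (ι-! J))) (recip4^-suc j) ⟩
    ι (suc (suc J)) * (- sign j * ((ι (suc (suc J)) * (ι (suc J) * F)) * ((¼ * R) * (I * I))))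
        ≡⟨ cong₂ (λ x y → x * (- sign j * ((x * (y * F)) * ((¼ * R) * (I * I))))) (ι-2+dbl j) (ι-1+dbl j) ⟩
    (1ℚ + (1ℚ + (u + u))) * (- sign j * (((1ℚ + (1ℚ + (u + u))) * ((1ℚ + (u + u)) * F)) * ((¼ * R) * (I * I))))
        ≡⟨ solve 5 (λ u σ f r i → let p = con 1ℚ :+ (u :+ u); q = con 1ℚ :+ p; j+1 = con 1ℚ :+ u in
                     q :* (:- σ :* ((q :* (p :* f)) :* ((con ¼ :* r) :* (i :* i))))
                     := :- p :* (σ :* (f :* (r :* ((i :* j+1) :* (i :* j+1))))))
             refl u (sign j) F R I ⟩
    - (1ℚ + (u + u)) * (sign j * (F * (R * ((I * (1ℚ + u)) * (I * (1ℚ + u))))))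
        ≡⟨ cong₂ (λ x y → - x * (sign j * (F * (R * (y * y))))) (sym (ι-1+dbl j))
                 (trans (cong (I *_) (sym (ι-suc j))) (inv!-suc j)) ⟩
    - ι (suc J) * (sign j * (F * (R * (inv! j * inv! j))))
        ≡⟨ cong (- ι (suc J) *_) (sym (∂arcsinhS-even j)) ⟩
    - ι (suc J) * E J ∎
    where
    open ≡-Reasoning
    E = ∂ arcsinhS
    J = dbl j
    F = ι (J !)
    R = recip4^ j
    I = inv! (suc j)
    u = ι j

  -- arcsinh′ = (1 + x²)^(-1/2), hence (1 + x²) arcsinh″ = - x arcsinh′.
  arcsinh-ode : 1+𝕩² ⊛ ∂ (∂ arcsinhS) ≈ (- 1ℚ) · (𝕩 ⊛ ∂ arcsinhS)
  arcsinh-ode N = begin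
    (1+𝕩² ⊛ ∂ E) N               ≡⟨ 1+𝕩²-⊛ (∂ E) N ⟩
    ∂ E N + (x· x· ∂ E) N        ≡⟨ by-degree N ⟩
    - (x· E) N                   ≡⟨ sym (trans (cong ((- 1ℚ) *_) (𝕩-⊛ E N)) (-1*x≡-x ((x· E) N))) ⟩
    (- 1ℚ) * (𝕩 ⊛ E) N           ∎
    where
    open ≡-Reasoning
    E = ∂ arcsinhS
    by-degree : ∀ N → ∂ E N + (x· x· ∂ E) N ≡ - (x· E) N
    by-degree zero = trans (cong (λ t → ι 1 * t + 0ℚ) (∂arcsinhS-odd 0)) (cong (_+ 0ℚ) (ℚₚ.*-zeroʳ (ι 1)))
    by-degree (suc zero) =
      trans (ℚₚ.+-identityʳ (∂ E 1)) (trans (∂arcsinhS-step 0) (trans (cong (λ t → - t * E 0) ι-1) (-1*x≡-x (E 0))))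
    by-degree (suc (suc K)) = by-parity (parity K)
      where
      by-parity : ∀ {K} → Parity K → ∂ E (suc (suc K)) + (x· x· ∂ E) (suc (suc K)) ≡ - (x· E) (suc (suc K))
      by-parity (even j) = begin
        ι (suc (suc (suc (dbl j)))) * E (suc (dbl (suc j))) + ι (suc (dbl j)) * E (suc (dbl j))
            ≡⟨ cong₂ (λ x y → ι (suc (suc (suc (dbl j)))) * x + ι (suc (dbl j)) * y)
                     (∂arcsinhS-odd (suc j)) (∂arcsinhS-odd j) ⟩
        ι (suc (suc (suc (dbl j)))) * 0ℚ + ι (suc (dbl j)) * 0ℚ
            ≡⟨ solve 2 (λ a b → a :* con 0ℚ :+ b :* con 0ℚ := :- con 0ℚ) refl
                 (ι (suc (suc (suc (dbl j))))) (ι (suc (dbl j))) ⟩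
        - 0ℚ
            ≡⟨ cong -_ (sym (∂arcsinhS-odd j)) ⟩
        - E (suc (dbl j)) ∎
      by-parity (odd j) = begin
        ι (suc (suc (suc (suc J)))) * E (dbl (suc (suc j))) + ι (suc (suc J)) * E (dbl (suc j))
            ≡⟨ cong (_+ ι (suc (suc J)) * E (dbl (suc j))) (∂arcsinhS-step (suc j)) ⟩
        - ι (suc (suc (suc J))) * E (dbl (suc j)) + ι (suc (suc J)) * E (dbl (suc j))
            ≡⟨ cong (λ t → - t * E (dbl (suc j)) + ι (suc (suc J)) * E (dbl (suc j))) (ι-suc (suc (suc J))) ⟩
        - (1ℚ + ι (suc (suc J))) * E (dbl (suc j)) + ι (suc (suc J)) * E (dbl (suc j))
            ≡⟨ solve 2 (λ a e → :- (con 1ℚ :+ a) :* e :+ a :* e := :- e) refl (ι (suc (suc J))) (E (dbl (suc j))) ⟩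
        - E (dbl (suc j)) ∎
        where J = dbl j

  arcsinh′-sq : 1+𝕩² ⊛ (∂ arcsinhS ⊛ ∂ arcsinhS) ≈ 𝟙
  arcsinh′-sq = ∂≈0⇒≈𝟙 ∂≈0 (trans (cong (λ t → 1+𝕩² 0 * (t * t)) E0≡1) refl)
    where
    E = ∂ arcsinhS
    E0≡1 : E 0 ≡ 1ℚ
    E0≡1 = trans (cong (_* arcsinhS 1) ι-1) refl
    Y : ℕ → ℚ
    Y N = ((𝕩 ⊛ E) ⊛ E) N
    1+𝕩²⊛∂E⊛E : ∀ N → (1+𝕩² ⊛ (∂ E ⊛ E)) N ≡ - 1ℚ * Y N
    1+𝕩²⊛∂E⊛E N = trans (sym (⊛-assoc 1+𝕩² (∂ E) E N))
      (trans (⊛-congˡ E arcsinh-ode N) (·-⊛ (- 1ℚ) (𝕩 ⊛ E) E N))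
    ∂≈0 : ∀ N → ∂ (1+𝕩² ⊛ (E ⊛ E)) N ≡ 0ℚ
    ∂≈0 N = begin
      ∂ (1+𝕩² ⊛ (E ⊛ E)) N
          ≡⟨ ∂-⊛ 1+𝕩² (E ⊛ E) N ⟩
      (∂ 1+𝕩² ⊛ (E ⊛ E)) N + (1+𝕩² ⊛ ∂ (E ⊛ E)) N
          ≡⟨ cong₂ _+_ (trans (⊛-congˡ (E ⊛ E) ∂-1+𝕩² N)
                         (trans (·-⊛ (ι 2) 𝕩 (E ⊛ E) N) (cong (ι 2 *_) (sym (⊛-assoc 𝕩 E E N)))))
                       (trans (⊛-congʳ 1+𝕩² (∂-⊛ E E) N) (trans (⊛-distribˡ-⊕ 1+𝕩² (∂ E ⊛ E) (E ⊛ ∂ E) N)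
                         (cong₂ _+_ (1+𝕩²⊛∂E⊛E N)
                                    (trans (⊛-congʳ 1+𝕩² (⊛-comm E (∂ E)) N) (1+𝕩²⊛∂E⊛E N))))) ⟩
      ι 2 * Y N + (- 1ℚ * Y N + - 1ℚ * Y N)
          ≡⟨ cong (λ t → t * Y N + (- 1ℚ * Y N + - 1ℚ * Y N)) (trans (ι-suc 1) (cong (_+_ 1ℚ) ι-1)) ⟩
      (1ℚ + 1ℚ) * Y N + (- 1ℚ * Y N + - 1ℚ * Y N)
          ≡⟨ solve 1 (λ y → (con 1ℚ :+ con 1ℚ) :* y :+ ((:- con 1ℚ) :* y :+ (:- con 1ℚ) :* y) := con 0ℚ) refl (Y N) ⟩
      0ℚ ∎
      where open ≡-Reasoning

  arcsinh-pow-ode : ∀ m → 1+𝕩² ⊛ ∂ (∂ (powCoeff arcsinhS (suc (suc m)))) ⊕ 𝕩 ⊛ ∂ (powCoeff arcsinhS (suc (suc m)))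
                          ≈ ι (suc (suc m)) · ι (suc m) · powCoeff arcsinhS m
  arcsinh-pow-ode m N = begin
    (1+𝕩² ⊛ ∂ (∂ (Z (suc (suc m))))) N + (𝕩 ⊛ ∂ (Z (suc (suc m)))) N
        ≡⟨ cong₂ _+_ (trans (⊛-congʳ 1+𝕩² (∂²-pow arcsinhS m) N) (⊛-· (ι (suc (suc m))) 1+𝕩² W N))
                     (trans (⊛-congʳ 𝕩 (∂-pow arcsinhS (suc m)) N) (⊛-· (ι (suc (suc m))) 𝕩 (Z (suc m) ⊛ E) N)) ⟩
    ι (suc (suc m)) * (1+𝕩² ⊛ W) N + ι (suc (suc m)) * Y
        ≡⟨ cong (λ t → ι (suc (suc m)) * t + ι (suc (suc m)) * Y)
                (trans (⊛-distribˡ-⊕ 1+𝕩² (ι (suc m) · (Z m ⊛ (E ⊛ E))) (Z (suc m) ⊛ ∂ E) N)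
                       (cong₂ _+_ (trans (⊛-· (ι (suc m)) 1+𝕩² (Z m ⊛ (E ⊛ E)) N) (cong (ι (suc m) *_) E²-part))
                                  ∂E-part)) ⟩
    ι (suc (suc m)) * (ι (suc m) * Z m N + - 1ℚ * Y) + ι (suc (suc m)) * Y
        ≡⟨ solve 4 (λ a b x y → a :* (b :* x :+ (:- con 1ℚ) :* y) :+ a :* y := a :* (b :* x)) refl
             (ι (suc (suc m))) (ι (suc m)) (Z m N) Y ⟩
    ι (suc (suc m)) * (ι (suc m) * Z m N) ∎
    where
    open ≡-Reasoning
    Z = powCoeff arcsinhS
    E = ∂ arcsinhS
    W = ι (suc m) · (Z m ⊛ (E ⊛ E)) ⊕ Z (suc m) ⊛ ∂ E
    Y = (𝕩 ⊛ (Z (suc m) ⊛ E)) N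
    E²-part : (1+𝕩² ⊛ (Z m ⊛ (E ⊛ E))) N ≡ Z m N
    E²-part = trans (⊛-leftComm 1+𝕩² (Z m) (E ⊛ E) N)
      (trans (⊛-congʳ (Z m) arcsinh′-sq N) (⊛-identityʳ (Z m) N))
    ∂E-part : (1+𝕩² ⊛ (Z (suc m) ⊛ ∂ E)) N ≡ - 1ℚ * Y
    ∂E-part = trans (⊛-leftComm 1+𝕩² (Z (suc m)) (∂ E) N) (trans (⊛-congʳ (Z (suc m)) arcsinh-ode N)
      (trans (⊛-· (- 1ℚ) (Z (suc m)) (𝕩 ⊛ E) N) (cong (- 1ℚ *_) (⊛-leftComm (Z (suc m)) 𝕩 E N))))

  arcsinh-triangle : IsStirlingTriangle (λ m _ → - ι (dbl m ℕ.* dbl m)) (evenPowerCoeff arcsinhS)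
  arcsinh-triangle = evenPowerCoeff-triangle arcsinhS _ refl recurrence
    where
    recurrence : EvenPowerRecurrence arcsinhS (λ m _ → - ι (dbl m ℕ.* dbl m))
    recurrence m j = begin
      ∂ (∂ f) M
          ≡⟨ solve 3 (λ d s b → d := (d :+ s :* b) :+ (:- s) :* b) refl (∂ (∂ f) M) (ι (M ℕ.* M)) (f M) ⟩
      (∂ (∂ f) M + ι (M ℕ.* M) * f M) + - ι (M ℕ.* M) * f M
          ≡⟨ cong (_+ - ι (M ℕ.* M) * f M) (trans (sym (coeff-1+𝕩²∂²+𝕩∂ f M)) (arcsinh-pow-ode (dbl j) M)) ⟩
      ι (suc (suc (dbl j))) * (ι (suc (dbl j)) * powCoeff arcsinhS (dbl j) M) + - ι (M ℕ.* M) * f M ∎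
      where
      open ≡-Reasoning
      M = dbl m
      f = powCoeff arcsinhS (dbl (suc j))

  stirling1₂-triangle : IsStirlingTriangle (λ n _ → ι (n ℕ.* n)) (λ n m → ι (stirling1₂ n m))
  stirling1₂-triangle = record
    { zero-zero = ι-1
    ; zero-suc  = λ _ → ι-0
    ; suc-zero  = λ _ → ι-0
    ; suc-suc   = λ n m → trans (ι-+ _ _) (cong (_+_ (ι (stirling1₂ n m))) (ι-* (n ℕ.* n) _))
    }

  stirling2₂-above-diagonal : ∀ {n m} → n < m → stirling2₂ n m ≡ 0
  stirling2₂-above-diagonal {zero}  {suc m} _         = refl
  stirling2₂-above-diagonal {suc n} {suc m} (s≤s n<m) = begin
    stirling2₂ n m ℕ.+ (suc m ℕ.* suc m) ℕ.* stirling2₂ n (suc m)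
        ≡⟨ cong₂ (λ x y → x ℕ.+ (suc m ℕ.* suc m) ℕ.* y)
                 (stirling2₂-above-diagonal n<m) (stirling2₂-above-diagonal (ℕₚ.m<n⇒m<1+n n<m)) ⟩
    (suc m ℕ.* suc m) ℕ.* 0
        ≡⟨ ℕₚ.*-zeroʳ (suc m ℕ.* suc m) ⟩
    0 ∎
    where open ≡-Reasoning

  stirling2₂-triangle : IsStirlingTriangle (λ _ m → ι (dbl (suc m) ℕ.* dbl (suc m)))
                                           (λ n m → ι (stirling2₂ n m ℕ.* 4 ^ (n ∸ m)))
  stirling2₂-triangle = record
    { zero-zero = ι-1
    ; zero-suc  = λ _ → ι-0
    ; suc-zero  = λ _ → ι-0
    ; suc-suc   = λ n m → trans (cong ι (step n m (m ℕ.<? n)))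
                            (trans (ι-+ _ _) (cong (_+_ (ι (stirling2₂ n m ℕ.* 4 ^ (n ∸ m)))) (ι-* _ _)))
    }
    where
    step : ∀ n m → Dec (m < n) →
      (stirling2₂ n m ℕ.+ (suc m ℕ.* suc m) ℕ.* stirling2₂ n (suc m)) ℕ.* 4 ^ (n ∸ m)
        ≡ stirling2₂ n m ℕ.* 4 ^ (n ∸ m)
          ℕ.+ (dbl (suc m) ℕ.* dbl (suc m)) ℕ.* (stirling2₂ n (suc m) ℕ.* 4 ^ (n ∸ suc m))
    step (suc n) m (yes (s≤s m≤n)) = begin
      (a ℕ.+ (suc m ℕ.* suc m) ℕ.* b) ℕ.* 4 ^ (suc n ∸ m)
          ≡⟨ cong (λ d → (a ℕ.+ (suc m ℕ.* suc m) ℕ.* b) ℕ.* 4 ^ d) (ℕₚ.+-∸-assoc 1 m≤n) ⟩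
      (a ℕ.+ (suc m ℕ.* suc m) ℕ.* b) ℕ.* (4 ℕ.* 4 ^ (n ∸ m))
          ≡⟨ solveℕ 4 (λ a t b p → (a ℕ:+ (t ℕ:* t) ℕ:* b) ℕ:* (conℕ 4 ℕ:* p)
                               ℕ:= a ℕ:* (conℕ 4 ℕ:* p) ℕ:+ ((conℕ 2 ℕ:* t) ℕ:* (conℕ 2 ℕ:* t)) ℕ:* (b ℕ:* p))
               refl a (suc m) b (4 ^ (n ∸ m)) ⟩
      a ℕ.* (4 ℕ.* 4 ^ (n ∸ m)) ℕ.+ (2 ℕ.* suc m ℕ.* (2 ℕ.* suc m)) ℕ.* (b ℕ.* 4 ^ (n ∸ m))
          ≡⟨ cong₂ (λ d t → a ℕ.* 4 ^ d ℕ.+ (t ℕ.* t) ℕ.* (b ℕ.* 4 ^ (n ∸ m)))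
                   (sym (ℕₚ.+-∸-assoc 1 m≤n)) (2*≡dbl (suc m)) ⟩
      a ℕ.* 4 ^ (suc n ∸ m) ℕ.+ (dbl (suc m) ℕ.* dbl (suc m)) ℕ.* (b ℕ.* 4 ^ (n ∸ m)) ∎
      where
      open ≡-Reasoning
      open ℕ-Solver.+-*-Solver using ()
        renaming (solve to solveℕ; _:+_ to _ℕ:+_; _:*_ to _ℕ:*_; _:=_ to _ℕ:=_; con to conℕ)
      a = stirling2₂ (suc n) m
      b = stirling2₂ (suc n) (suc m)
    step n m (no m≮n) = begin
      (a ℕ.+ (suc m ℕ.* suc m) ℕ.* b) ℕ.* p
          ≡⟨ cong (λ x → (a ℕ.+ (suc m ℕ.* suc m) ℕ.* x) ℕ.* p) b≡0 ⟩
      (a ℕ.+ (suc m ℕ.* suc m) ℕ.* 0) ℕ.* p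
          ≡⟨ cong (λ x → (a ℕ.+ x) ℕ.* p) (ℕₚ.*-zeroʳ (suc m ℕ.* suc m)) ⟩
      (a ℕ.+ 0) ℕ.* p
          ≡⟨ cong (ℕ._* p) (ℕₚ.+-identityʳ a) ⟩
      a ℕ.* p
          ≡⟨ sym (ℕₚ.+-identityʳ (a ℕ.* p)) ⟩
      a ℕ.* p ℕ.+ 0
          ≡⟨ cong (λ x → a ℕ.* p ℕ.+ x) (sym (ℕₚ.*-zeroʳ (dbl (suc m) ℕ.* dbl (suc m)))) ⟩
      a ℕ.* p ℕ.+ (dbl (suc m) ℕ.* dbl (suc m)) ℕ.* 0
          ≡⟨ cong (λ x → a ℕ.* p ℕ.+ (dbl (suc m) ℕ.* dbl (suc m)) ℕ.* (x ℕ.* 4 ^ (n ∸ suc m))) (sym b≡0) ⟩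
      a ℕ.* p ℕ.+ (dbl (suc m) ℕ.* dbl (suc m)) ℕ.* (b ℕ.* 4 ^ (n ∸ suc m)) ∎
      where
      open ≡-Reasoning
      a = stirling2₂ n m
      b = stirling2₂ n (suc m)
      p = 4 ^ (n ∸ m)
      b≡0 : b ≡ 0
      b≡0 = stirling2₂-above-diagonal (s≤s (ℕₚ.≮⇒≥ m≮n))

  polyBernoulli₂-even : ∀ m k → polyBernoulli₂ (2 ℕ.* m) k
    ≡ sumTo (dbl m) (λ j → evenPowerCoeff twoSinHalf m j * (ι (dbl j !) * invPowℤ (dbl j) k))
  polyBernoulli₂-even m k = begin
    polyBernoulli₂ (2 ℕ.* m) k
        ≡⟨ cong (λ t → polyBernoulli₂ t k) (2*≡dbl m) ⟩
    ℕ→ℚ (M !) * sumTo M (λ j → P (2 ℕ.* j) M * invPowℤ (2 ℕ.* j) k)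
        ≡⟨ cong₂ _*_ (sym (ι-def (M !))) (sumTo-cong M (λ j _ → cong (λ t → P t M * invPowℤ t k) (2*≡dbl j))) ⟩
    ι (M !) * sumTo M (λ j → P (dbl j) M * invPowℤ (dbl j) k)
        ≡⟨ sym (sumTo-*ˡ M (ι (M !)) (λ j → P (dbl j) M * invPowℤ (dbl j) k)) ⟩
    sumTo M (λ j → ι (M !) * (P (dbl j) M * invPowℤ (dbl j) k))
        ≡⟨ sumTo-cong M (λ j _ → regroup j) ⟩
    sumTo M (λ j → evenPowerCoeff twoSinHalf m j * (ι (dbl j !) * invPowℤ (dbl j) k)) ∎
    where
    open ≡-Reasoning
    M = dbl m
    P = powCoeff twoSinHalf
    regroup : ∀ j → ι (M !) * (P (dbl j) M * invPowℤ (dbl j) k)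
                    ≡ evenPowerCoeff twoSinHalf m j * (ι (dbl j !) * invPowℤ (dbl j) k)
    regroup j = sym (begin
      (ι (M !) * P (dbl j) M * inv! (dbl j)) * (ι (dbl j !) * invPowℤ (dbl j) k)
          ≡⟨ solve 5 (λ f p g h v → (f :* p :* g) :* (h :* v) := (f :* (p :* v)) :* (g :* h)) refl
               (ι (M !)) (P (dbl j) M) (inv! (dbl j)) (ι (dbl j !)) (invPowℤ (dbl j) k) ⟩
      (ι (M !) * (P (dbl j) M * invPowℤ (dbl j) k)) * (inv! (dbl j) * ι (dbl j !))
          ≡⟨ cong ((ι (M !) * (P (dbl j) M * invPowℤ (dbl j) k)) *_) (recip-*-ι (dbl j !) {{dbl j !≢0}}) ⟩
      (ι (M !) * (P (dbl j) M * invPowℤ (dbl j) k)) * 1ℚ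
          ≡⟨ ℚₚ.*-identityʳ _ ⟩
      ι (M !) * (P (dbl j) M * invPowℤ (dbl j) k) ∎)

  polyCauchy₂-even : ∀ m k → polyCauchy₂ (2 ℕ.* m) k
    ≡ sumTo (dbl m) (λ j → evenPowerCoeff arcsinhS m j * invPowℤ (dbl j) k)
  polyCauchy₂-even m k = begin
    polyCauchy₂ (2 ℕ.* m) k
        ≡⟨ cong (λ t → polyCauchy₂ t k) (2*≡dbl m) ⟩
    ℕ→ℚ (M !) * sumTo M (λ j → Z (2 ℕ.* j) M * (inv! (2 ℕ.* j) * invPowℤ (2 ℕ.* j) k))
        ≡⟨ cong₂ _*_ (sym (ι-def (M !)))
                 (sumTo-cong M (λ j _ → cong (λ t → Z t M * (inv! t * invPowℤ t k)) (2*≡dbl j))) ⟩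
    ι (M !) * sumTo M (λ j → Z (dbl j) M * (inv! (dbl j) * invPowℤ (dbl j) k))
        ≡⟨ sym (sumTo-*ˡ M (ι (M !)) (λ j → Z (dbl j) M * (inv! (dbl j) * invPowℤ (dbl j) k))) ⟩
    sumTo M (λ j → ι (M !) * (Z (dbl j) M * (inv! (dbl j) * invPowℤ (dbl j) k)))
        ≡⟨ sumTo-cong M (λ j _ → solve 4 (λ f z g v → f :* (z :* (g :* v)) := (f :* z :* g) :* v) refl
                                   (ι (M !)) (Z (dbl j) M) (inv! (dbl j)) (invPowℤ (dbl j) k)) ⟩
    sumTo M (λ j → evenPowerCoeff arcsinhS m j * invPowℤ (dbl j) k) ∎
    where
    open ≡-Reasoning
    M = dbl m
    Z = powCoeff arcsinhS

  stirling1₂-polyBernoulli₂ : ∀ n k →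
    inv! (dbl n) * sumTo n (λ m → ℕ→ℚ (stirling1₂ n m) * polyBernoulli₂ (2 ℕ.* m) k) ≡ invPowℤ (dbl n) k
  stirling1₂-polyBernoulli₂ n k = begin
    inv! (dbl n) * sumTo n (λ m → ℕ→ℚ (stirling1₂ n m) * polyBernoulli₂ (2 ℕ.* m) k)
        ≡⟨ cong (inv! (dbl n) *_) (sumTo-cong n (λ m _ → cong₂ _*_ (sym (ι-def _)) (polyBernoulli₂-even m k))) ⟩
    inv! (dbl n) * sumTo n (λ m → ι (stirling1₂ n m) * sumTo (dbl m) (λ j → evenPowerCoeff twoSinHalf m j * h j))
        ≡⟨ cong (inv! (dbl n) *_) (sumTo-inversion n (λ m → ι (stirling1₂ n m)) (evenPowerCoeff twoSinHalf) h dbl m≤dbl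
             (weightedStirling₁-inverse (λ n → ι (n ℕ.* n)) ι-0 stirling1₂-triangle twoSinHalf-triangle n)
             (above-diagonal twoSinHalf-triangle)) ⟩
    inv! (dbl n) * (ι (dbl n !) * invPowℤ (dbl n) k)
        ≡⟨ sym (ℚₚ.*-assoc (inv! (dbl n)) _ _) ⟩
    (inv! (dbl n) * ι (dbl n !)) * invPowℤ (dbl n) k
        ≡⟨ cong (_* invPowℤ (dbl n) k) (recip-*-ι (dbl n !) {{dbl n !≢0}}) ⟩
    1ℚ * invPowℤ (dbl n) k
        ≡⟨ ℚₚ.*-identityˡ _ ⟩
    invPowℤ (dbl n) k ∎
    where
    open ≡-Reasoning
    h : ℕ → ℚ
    h j = ι (dbl j !) * invPowℤ (dbl j) k

  stirling2₂-polyCauchy₂ : ∀ n k →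
    sumTo n (λ m → ℕ→ℚ (stirling2₂ n m ℕ.* 4 ^ (n ∸ m)) * polyCauchy₂ (2 ℕ.* m) k) ≡ invPowℤ (dbl n) k
  stirling2₂-polyCauchy₂ n k = begin
    sumTo n (λ m → ℕ→ℚ (stirling2₂ n m ℕ.* 4 ^ (n ∸ m)) * polyCauchy₂ (2 ℕ.* m) k)
        ≡⟨ sumTo-cong n (λ m _ → cong₂ _*_ (sym (ι-def _)) (polyCauchy₂-even m k)) ⟩
    sumTo n (λ m → ι (stirling2₂ n m ℕ.* 4 ^ (n ∸ m)) * sumTo (dbl m) (λ j → evenPowerCoeff arcsinhS m j * h j))
        ≡⟨ sumTo-inversion n (λ m → ι (stirling2₂ n m ℕ.* 4 ^ (n ∸ m))) (evenPowerCoeff arcsinhS) h dbl m≤dbl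
             (weightedStirling₂-inverse (λ m → ι (dbl m ℕ.* dbl m)) ι-0 stirling2₂-triangle arcsinh-triangle n)
             (above-diagonal arcsinh-triangle) ⟩
    invPowℤ (dbl n) k ∎
    where
    open ≡-Reasoning
    h : ℕ → ℚ
    h j = invPowℤ (dbl j) k

open PolyBernoulliCauchy using (2*≡dbl; stirling1₂-polyBernoulli₂; stirling2₂-polyCauchy₂)

open import Defs
open import Data.Nat using (ℕ; _≤_; _∸_; _^_; _*_)
open import Data.Integer using (ℤ)
open import Data.Rational using (ℚ) renaming (_*_ to _*ℚ_)
open import Data.Product using (_×_; _,_)
open import Relation.Binary.PropositionalEquality using (_≡_; subst; sym)

theorem9 : (n : ℕ) → 1 ≤ n → (k : ℤ) →
    (inv! (2 * n) *ℚ sumTo n (λ m → ℕ→ℚ (stirling1₂ n m) *ℚ polyBernoulli₂ (2 * m) k)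
      ≡ invPowℤ (2 * n) k)
    × (sumTo n (λ m → ℕ→ℚ (stirling2₂ n m * 4 ^ (n ∸ m)) *ℚ polyCauchy₂ (2 * m) k)
      ≡ invPowℤ (2 * n) k)
theorem9 n _ k =
  subst (λ t → inv! t *ℚ sumTo n (λ m → ℕ→ℚ (stirling1₂ n m) *ℚ polyBernoulli₂ (2 * m) k) ≡ invPowℤ t k)
        (sym (2*≡dbl n)) (stirling1₂-polyBernoulli₂ n k) ,
  subst (λ t → sumTo n (λ m → ℕ→ℚ (stirling2₂ n m * 4 ^ (n ∸ m)) *ℚ polyCauchy₂ (2 * m) k) ≡ invPowℤ t k)
        (sym (2*≡dbl n)) (stirling2₂-polyCauchy₂ n k)
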